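{- Let $q$ be a prime power and $k,m$ positive integers with $(k-1)m$ even. Let $W$ be a $(k-1)$-dimensional $\mathbb{F}_{q^m}$-subspace of $\mathbb{F}_{q^m}^k$, $H=\mathrm{PG}(W,\mathbb{F}_{q^m})$, and $U'\subseteq W$ an $\mathbb{F}_q$-subspace with $L_{U'}$ a maximum scattered $\mathbb{F}_q$-linear set in $H$. Let $x\in\mathbb{F}_{q^m}^k$ with $\langle x\rangle_{\mathbb{F}_{q^m}}\cap W=\{0\}$, let $i\ge m/2$ be a positive integer, $U''$ an $i$-dimensional $\mathbb{F}_q$-subspace of $\langle x\rangle_{\mathbb{F}_{q^m}}$, and $U=U'+U''$. Then for every hyperplane $\Omega$ of $\mathrm{PG}(k-1,q^m)$, \[ w_{L_U}(\Omega)\in\left\{\frac{m(k-1)}{2},\ \frac{m(k-3)}{2},\ \frac{m(k-3)}{2}+1,\ \ldots,\ \frac{m(k-3)}{2}+i+1\right\},\] and there exists a hyperplane of weight $\frac{m(k-1)}{2}$.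
   Context: For an $\mathbb{F}_q$-subspace $U$ of $\mathbb{F}_{q^m}^k$, $L_U=\{\langle u\rangle_{\mathbb{F}_{q^m}} : u\in U\setminus\{0\}\}$; for an $\mathbb{F}_{q^m}$-subspace $T$, $w_{L_U}(\mathrm{PG}(T,\mathbb{F}_{q^m}))=\dim_{\mathbb{F}_q}(U\cap T)$. $L_U$ is scattered if all its points have weight $1$. For an $r$-dimensional $\mathbb{F}_{q^m}$-subspace $W$, $L_{U'}$ with $U'\subseteq W$ is maximum scattered in $\mathrm{PG}(W,\mathbb{F}_{q^m})$ if it is scattered and $\dim_{\mathbb{F}_q}U'=rm/2$. -}

module Defs where

open import Level using (0ℓ)
open import Algebra.Bundles using (CommutativeRing)
open import Data.Nat using (ℕ; zero; suc; _^_; _≤_)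
open import Data.Nat.Primality using (Prime)
open import Data.Fin using (Fin)
open import Data.Product using (Σ; ∃; _×_)
open import Data.Unit using (⊤)
open import Data.Empty using (⊥)
open import Relation.Nullary using (¬_)
open import Relation.Binary.PropositionalEquality using (_≡_)

IsPrimePower : ℕ → Set
IsPrimePower q = Σ ℕ λ p → Σ ℕ λ e → Prime p × 1 ≤ e × q ≡ p ^ e

module _ (R : CommutativeRing 0ℓ 0ℓ) where
  open CommutativeRing R

  IsField : Set
  IsField = ¬ (1# ≈ 0#) × (∀ x → ¬ (x ≈ 0#) → Σ Carrier λ y → x * y ≈ 1#)

  HasCard : (Carrier → Set) → ℕ → Set
  HasCard P n = Σ (Fin n → Carrier) λ f →
      (∀ j → P (f j))
    × (∀ j j' → f j ≈ f j' → j ≡ j')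
    × (∀ x → P x → Σ (Fin n) λ j → f j ≈ x)

  Full : Carrier → Set
  Full _ = ⊤

  IsSubfield : (Carrier → Set) → Set
  IsSubfield P =
      (∀ {x y} → x ≈ y → P x → P y)
    × P 0# × P 1#
    × (∀ {x y} → P x → P y → P (x + y))
    × (∀ {x} → P x → P (- x))
    × (∀ {x y} → P x → P y → P (x * y))
    × (∀ {x y} → P x → x * y ≈ 1# → P y)

  Vect : ℕ → Set
  Vect k = Fin k → Carrier

  _≈v_ : ∀ {k} → Vect k → Vect k → Set
  u ≈v v = ∀ j → u j ≈ v j

  _+v_ : ∀ {k} → Vect k → Vect k → Vect k
  (u +v v) j = u j + v j

  _·v_ : ∀ {k} → Carrier → Vect k → Vect k
  (c ·v v) j = c * v j

  0v : ∀ {k} → Vect k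
  0v _ = 0#

  linComb : ∀ {k d} → (Fin d → Carrier) → (Fin d → Vect k) → Vect k
  linComb {d = zero} c b = 0v
  linComb {d = suc d} c b = (c Fin.zero ·v b Fin.zero) +v linComb (λ j → c (Fin.suc j)) (λ j → b (Fin.suc j))

  IsSubspace : (P : Carrier → Set) → ∀ {k} → (Vect k → Set) → Set
  IsSubspace P S =
      (∀ {u v} → u ≈v v → S u → S v)
    × S 0v
    × (∀ {u v} → S u → S v → S (u +v v))
    × (∀ {c v} → P c → S v → S (c ·v v))

  HasDim : (P : Carrier → Set) → ∀ {k} → (Vect k → Set) → ℕ → Set
  HasDim P S d = Σ (Fin d → Vect _) λ b →
      (∀ j → S (b j))
    × (∀ c → (∀ j → P (c j)) → linComb c b ≈v 0v → ∀ j → c j ≈ 0#)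
    × (∀ v → S v → Σ (Fin d → Carrier) λ c → (∀ j → P (c j)) × linComb c b ≈v v)

  _⊆_ : ∀ {k} → (Vect k → Set) → (Vect k → Set) → Set
  S ⊆ T = ∀ v → S v → T v

  _∩_ : ∀ {k} → (Vect k → Set) → (Vect k → Set) → Vect k → Set
  (S ∩ T) v = S v × T v

  _⊕_ : ∀ {k} → (Vect k → Set) → (Vect k → Set) → Vect k → Set
  (S ⊕ T) v = Σ (Vect _) λ s → Σ (Vect _) λ t → S s × T t × (v ≈v (s +v t))

  span1 : ∀ {k} → Vect k → Vect k → Set
  span1 x v = Σ Carrier λ c → v ≈v (c ·v x)

  -- weight of the projective subspace PG(T) w.r.t. L_U is w
  HasWeight : (Fq : Carrier → Set) → ∀ {k} → (U T : Vect k → Set) → ℕ → Set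
  HasWeight Fq U T w = HasDim Fq (U ∩ T) w

  -- L_U (U an Fq-subspace) is scattered: every point ⟨u⟩ (u ∈ U∖{0}) has weight 1
  Scattered : (Fq : Carrier → Set) → ∀ {k} → (Vect k → Set) → Set
  Scattered Fq U = ∀ u → U u → ¬ (u ≈v 0v) → HasWeight Fq U (span1 u) 1

  IsHyperplane : ∀ {k} → (Vect k → Set) → Set
  IsHyperplane {k} Ω = IsSubspace Full Ω × HasDim Full Ω (k Data.Nat.∸ 1)

-- U = U' + U'' is a direct sum of Fq-dimension h + i, because U'' ⊆ ⟨x⟩ meets W trivially.
-- A hyperplane Ω containing W equals W, and U ∩ W = U', so Ω has weight h. Any other hyperplane
-- is the kernel of a K-linear functional ψ that does not vanish on W. Rank–nullity for ψ on U
-- gives w ≥ h + i − m, and w ≤ h + i − dim ψ(U'); so it remains to see that ψ(U') has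
-- Fq-codimension at most 1 in K. Otherwise two independent Fq-linear functionals f₁, f₂ : K → Fq
-- vanish on ψ(U'), and since every Fq-linear functional is f₁(μ ·) for some μ ∈ K, f₂ = f₁(μ ·)
-- with μ ∉ Fq. Then f₁ ∘ ψ vanishes on U' + μU', which is direct because L_U' is scattered,
-- hence 2h-dimensional, but not on W, which has Fq-dimension (k − 1)m = 2h.

module Submission where

open import Level using (0ℓ)
open import Algebra.Bundles using (CommutativeRing)
open import Data.Empty using (⊥; ⊥-elim)
open import Data.Fin as Fin using (Fin; zero; suc; punchIn; splitAt; _↑ˡ_; _↑ʳ_)
import Data.Fin.Properties as Finₚ
open import Data.Integer as ℤ using (+_; _⊖_)
import Data.Integer.Properties as ℤₚ
open import Data.Integer.Solver using (module +-*-Solver)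
open import Data.Nat as ℕ using (ℕ; zero; suc; _≤_; z≤n; s≤s)
import Data.Nat.Properties as ℕₚ
open import Data.Product using (Σ; _×_; _,_; proj₁; proj₂)
open import Data.Sum using (_⊎_; inj₁; inj₂)
open import Data.Sum.Properties using ([,]-map; [,]-∘; [,]-cong)
open import Data.Unit using (tt)
open import Data.Vec.Functional using ([]; _∷_; _++_; insertAt; removeAt; tail)
open import Data.Vec.Functional.Properties using (insertAt-lookup; insertAt-punchIn; lookup-++ˡ; lookup-++ʳ)
open import Data.Vec.Functional.Relation.Unary.All using (All)
open import Data.Vec.Functional.Relation.Unary.All.Properties using (++⁺)
open import Function using (_∘_; const)
open import Relation.Binary.Definitions using (Decidable)
open import Relation.Binary.PropositionalEquality as ≡ using (_≡_; _≢_)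
open import Relation.Nullary using (¬_; Dec; yes; no; ¬?)
import Relation.Unary as Unary
open import Defs hiding (linComb)
import Defs

funToFin-cong : ∀ {m n} {f g : Fin m → Fin n} → (∀ j → f j ≡ g j) → Fin.funToFin f ≡ Fin.funToFin g
funToFin-cong {zero} f≗g = ≡.refl
funToFin-cong {suc m} f≗g = ≡.cong₂ Fin.combine (f≗g zero) (funToFin-cong (f≗g ∘ suc))

^-cancelˡ-≤ : ∀ {q a b} → 1 ℕ.< q → q ℕ.^ a ≤ q ℕ.^ b → a ≤ b
^-cancelˡ-≤ {q} {a} {b} 1<q qᵃ≤qᵇ with a ℕ.≤? b
... | yes a≤b = a≤b
... | no a≰b = ⊥-elim (ℕₚ.<⇒≱ (ℕₚ.^-monoʳ-< q 1<q (ℕₚ.≰⇒> a≰b)) qᵃ≤qᵇ)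

↑ˡ≢↑ʳ : ∀ {a b} (i : Fin b) (j : Fin a) → i ↑ˡ a ≢ b ↑ʳ j
↑ˡ≢↑ʳ {a} {b} i j eq
  with ≡.trans (≡.sym (Finₚ.splitAt-↑ˡ b i a)) (≡.trans (≡.cong (splitAt b) eq) (Finₚ.splitAt-↑ʳ b a j))
... | ()

n+o⊖n≡o : ∀ n o → (n ℕ.+ o) ⊖ n ≡ + o
n+o⊖n≡o n o = ≡.trans (≡.cong ((n ℕ.+ o) ⊖_) (≡.sym (ℕₚ.+-identityʳ n))) (ℤₚ.+-cancelˡ-⊖ n o 0)

m≤n+o⇒m-n≤o : ∀ {m n o} → m ≤ n ℕ.+ o → + m ℤ.- + n ℤ.≤ + o
m≤n+o⇒m-n≤o {m} {n} {o} m≤n+o =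
  ≡.subst₂ ℤ._≤_ (≡.sym (ℤₚ.[+m]-[+n]≡m⊖n m n)) (n+o⊖n≡o n o) (ℤₚ.⊖-monoˡ-≤ n m≤n+o)

m+n≤o⇒m≤o-n : ∀ {m n o} → m ℕ.+ n ≤ o → + m ℤ.≤ + o ℤ.- + n
m+n≤o⇒m≤o-n {m} {n} {o} m+n≤o =
  ≡.subst₂ ℤ._≤_ (n+o⊖n≡o n m) (≡.sym (ℤₚ.[+m]-[+n]≡m⊖n o n))
    (ℤₚ.⊖-monoˡ-≤ n (≡.subst (_≤ o) (ℕₚ.+-comm m n) m+n≤o))

+[1+a+c]-b≡a-b+c+1 : ∀ a b c → + suc (a ℕ.+ c) ℤ.- + b ≡ + a ℤ.- + b ℤ.+ + c ℤ.+ + 1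
+[1+a+c]-b≡a-b+c+1 a b c =
  ≡.trans (≡.cong (λ n → n ℤ.- + b) (≡.trans (ℤₚ.pos-+ 1 (a ℕ.+ c)) (≡.cong (ℤ._+_ (+ 1)) (ℤₚ.pos-+ a c))))
  (solve 3 (λ a b c → con (+ 1) :+ (a :+ c) :- b := a :- b :+ c :+ con (+ 1)) ≡.refl (+ a) (+ b) (+ c))
  where open +-*-Solver

two-distinct : ∀ {b} → 2 ≤ b → Σ (Fin b) λ i → Σ (Fin b) λ j → i ≢ j
two-distinct (s≤s (s≤s _)) = zero , suc zero , λ ()

module _ (K : CommutativeRing 0ℓ 0ℓ) where
  open CommutativeRing K

  hasCard⇒decidable : ∀ {N} → HasCard K (Full K) N → Decidable _≈_
  hasCard⇒decidable (element , _ , element-injective , element-surjective) x y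
    with element-surjective x tt | element-surjective y tt
  ... | i , eᵢ≈x | j , eⱼ≈y with i Fin.≟ j
  ...   | yes ≡.refl = yes (trans (sym eᵢ≈x) eⱼ≈y)
  ...   | no i≢j = no λ x≈y → i≢j (element-injective i j (trans eᵢ≈x (trans x≈y (sym eⱼ≈y))))

module Vectors (K : CommutativeRing 0ℓ 0ℓ) where
  open CommutativeRing K hiding (zero)
  open import Algebra.Solver.Ring.NaturalCoefficients.Default commutativeSemiring
    using (solve; _:=_; _:+_; _:*_)
  open import Algebra.Properties.Ring ring using (-1*x≈-x)
  open import Data.Vec.Functional.Relation.Binary.Equality.Setoid setoid public
    using (_≋_; ≋-refl; ≋-sym; ≋-trans; ≋-reflexive)

  V : ℕ → Set
  V = Vect K

  infixl 6 _⊞_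
  infixl 7 _⊙_

  _⊞_ : ∀ {n} → V n → V n → V n
  _⊞_ = _+v_ K

  _⊙_ : ∀ {n} → Carrier → V n → V n
  _⊙_ = _·v_ K

  𝟘 : ∀ {n} → V n
  𝟘 = 0v K

  linComb : ∀ {d n} → (Fin d → Carrier) → (Fin d → V n) → V n
  linComb = Defs.linComb K

  ++-tail : ∀ {A : Set} {a b} (f : Fin (suc a) → A) (g : Fin b → A) j → (f ++ g) (suc j) ≡ (tail f ++ g) j
  ++-tail {a = a} f g j = [,]-map (splitAt a j)

  ++-split : ∀ {A : Set} {a b} (f : Fin (a ℕ.+ b) → A) j → f j ≡ ((f ∘ (_↑ˡ b)) ++ (f ∘ (a ↑ʳ_))) j
  ++-split {a = a} {b} f j = ≡.trans (≡.cong f (≡.sym (Finₚ.join-splitAt a b j))) ([,]-∘ f (splitAt a j))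

  ∘-++-[] : ∀ {A B : Set} {a} (f : A → B) (xs : Fin a → A) j → f ((xs ++ []) j) ≡ ((f ∘ xs) ++ []) j
  ∘-++-[] {a = a} f xs j = ≡.trans ([,]-∘ f (splitAt a j)) ([,]-cong (λ _ → ≡.refl) (λ ()) (splitAt a j))

  δ : ∀ {n} → Fin n → V n
  δ {suc n} j = insertAt (const 0#) j 1#

  δ-diagonal : ∀ {n} (j : Fin n) → δ j j ≈ 1#
  δ-diagonal {suc n} j = reflexive (insertAt-lookup (const 0#) j 1#)

  δ-punchIn : ∀ {n} (i : Fin (suc n)) j → δ i (punchIn i j) ≈ 0#
  δ-punchIn i j = reflexive (insertAt-punchIn (const 0#) i 1# j)

  δ-offDiagonal : ∀ {n} (i j : Fin n) → i ≢ j → δ i j ≈ 0#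
  δ-offDiagonal {suc n} i j i≢j =
    trans (reflexive (≡.cong (δ i) (≡.sym (Finₚ.punchIn-punchOut i≢j)))) (δ-punchIn i _)

  module _ {n : ℕ} where
    linComb-cong : ∀ {d} {c c' : Fin d → Carrier} {b b' : Fin d → V n} →
                   (∀ j → c j ≈ c' j) → (∀ j → b j ≋ b' j) → linComb c b ≋ linComb c' b'
    linComb-cong {zero} cc bb t = refl
    linComb-cong {suc d} cc bb t = +-cong (*-cong (cc zero) (bb zero t)) (linComb-cong (cc ∘ suc) (bb ∘ suc) t)

    linComb-+ : ∀ {d} (c c' : Fin d → Carrier) (b : Fin d → V n) →
                linComb (λ j → c j + c' j) b ≋ linComb c b ⊞ linComb c' b
    linComb-+ {zero} c c' b t = sym (+-identityʳ 0#)
    linComb-+ {suc d} c c' b t = trans (+-congˡ (linComb-+ (c ∘ suc) (c' ∘ suc) (b ∘ suc) t))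
      (solve 5 (λ x y z u w → (x :+ y) :* z :+ (u :+ w) := (x :* z :+ u) :+ (y :* z :+ w)) refl
         (c zero) (c' zero) (b zero t) (linComb (c ∘ suc) (b ∘ suc) t) (linComb (c' ∘ suc) (b ∘ suc) t))

    linComb-* : ∀ {d} (a : Carrier) (c : Fin d → Carrier) (b : Fin d → V n) →
                linComb (λ j → a * c j) b ≋ a ⊙ linComb c b
    linComb-* {zero} a c b t = sym (zeroʳ a)
    linComb-* {suc d} a c b t = trans (+-congˡ (linComb-* a (c ∘ suc) (b ∘ suc) t))
      (solve 4 (λ a x z u → a :* x :* z :+ a :* u := a :* (x :* z :+ u)) refl
         a (c zero) (b zero t) (linComb (c ∘ suc) (b ∘ suc) t))

    linComb-neg : ∀ {d} (c : Fin d → Carrier) (b : Fin d → V n) t → linComb (λ j → - c j) b t ≈ - linComb c b t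
    linComb-neg c b t = begin
      linComb (λ j → - c j) b t      ≈⟨ linComb-cong (λ j → -1*x≈-x (c j)) (λ _ → ≋-refl) t ⟨
      linComb (λ j → - 1# * c j) b t ≈⟨ linComb-* (- 1#) c b t ⟩
      - 1# * linComb c b t           ≈⟨ -1*x≈-x _ ⟩
      - linComb c b t                ∎
      where open import Relation.Binary.Reasoning.Setoid setoid

    linComb-⊞ : ∀ {d} (c : Fin d → Carrier) (b b' : Fin d → V n) →
                linComb c (λ j → b j ⊞ b' j) ≋ linComb c b ⊞ linComb c b'
    linComb-⊞ {zero} c b b' t = sym (+-identityʳ 0#)
    linComb-⊞ {suc d} c b b' t = trans (+-congˡ (linComb-⊞ (c ∘ suc) (b ∘ suc) (b' ∘ suc) t))
      (solve 5 (λ x y z u w → x :* (y :+ z) :+ (u :+ w) := (x :* y :+ u) :+ (x :* z :+ w)) refl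
         (c zero) (b zero t) (b' zero t) (linComb (c ∘ suc) (b ∘ suc) t) (linComb (c ∘ suc) (b' ∘ suc) t))

    linComb-⊙ : ∀ {d} (a : Carrier) (c : Fin d → Carrier) (b : Fin d → V n) →
                linComb c (λ j → a ⊙ b j) ≋ a ⊙ linComb c b
    linComb-⊙ {zero} a c b t = sym (zeroʳ a)
    linComb-⊙ {suc d} a c b t = trans (+-congˡ (linComb-⊙ a (c ∘ suc) (b ∘ suc) t))
      (solve 4 (λ a x z u → x :* (a :* z) :+ a :* u := a :* (x :* z :+ u)) refl
         a (c zero) (b zero t) (linComb (c ∘ suc) (b ∘ suc) t))

    linComb-zeroˡ : ∀ {d} (b : Fin d → V n) → linComb (const 0#) b ≋ 𝟘
    linComb-zeroˡ {zero} b t = refl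
    linComb-zeroˡ {suc d} b t = trans (+-cong (zeroˡ _) (linComb-zeroˡ (b ∘ suc) t)) (+-identityʳ 0#)

    linComb-vanishesAt : ∀ {d} (c : Fin d → Carrier) {b : Fin d → V n} t → (∀ j → b j t ≈ 0#) → linComb c b t ≈ 0#
    linComb-vanishesAt {zero} c t b0 = refl
    linComb-vanishesAt {suc d} c t b0 =
      trans (+-cong (trans (*-congˡ (b0 zero)) (zeroʳ _)) (linComb-vanishesAt (c ∘ suc) t (b0 ∘ suc))) (+-identityʳ 0#)

    linComb-zeroʳ : ∀ {d} (c : Fin d → Carrier) {b : Fin d → V n} → (∀ j → b j ≋ 𝟘) → linComb c b ≋ 𝟘
    linComb-zeroʳ c b0 t = linComb-vanishesAt c t (λ j → b0 j t)

    linComb-removeAt : ∀ {d} (c : Fin (suc d) → Carrier) (b : Fin (suc d) → V n) j →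
                       linComb c b ≋ c j ⊙ b j ⊞ linComb (removeAt c j) (removeAt b j)
    linComb-removeAt c b zero t = refl
    linComb-removeAt {suc d} c b (suc j) t = trans (+-congˡ (linComb-removeAt (c ∘ suc) (b ∘ suc) j t))
      (solve 3 (λ x y z → x :+ (y :+ z) := y :+ (x :+ z)) refl
        (c zero * b zero t) (c (suc j) * b (suc j) t) (linComb (removeAt (c ∘ suc) j) (removeAt (b ∘ suc) j) t))

    linComb-++ : ∀ {a a'} (c : Fin a → Carrier) (c' : Fin a' → Carrier) (b : Fin a → V n) (b' : Fin a' → V n) →
                 linComb (c ++ c') (b ++ b') ≋ linComb c b ⊞ linComb c' b'
    linComb-++ {zero} c c' b b' t = sym (+-identityˡ _)
    linComb-++ {suc a} c c' b b' t = begin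
      c zero * b zero t + linComb ((c ++ c') ∘ suc) ((b ++ b') ∘ suc) t
        ≈⟨ +-congˡ (linComb-cong (reflexive ∘ ++-tail c c') (≋-reflexive ∘ ++-tail b b') t) ⟩
      c zero * b zero t + linComb (tail c ++ c') (tail b ++ b') t
        ≈⟨ +-congˡ (linComb-++ (tail c) c' (tail b) b' t) ⟩
      c zero * b zero t + (linComb (tail c) (tail b) t + linComb c' b' t)
        ≈⟨ +-assoc _ _ _ ⟨
      linComb c b t + linComb c' b' t
        ∎
      where open import Relation.Binary.Reasoning.Setoid setoid

    linComb-split : ∀ {a a'} (c : Fin (a ℕ.+ a') → Carrier) (b : Fin a → V n) (b' : Fin a' → V n) →
                    linComb c (b ++ b') ≋ linComb (c ∘ (_↑ˡ a')) b ⊞ linComb (c ∘ (a ↑ʳ_)) b'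
    linComb-split {a} c b b' = ≋-trans (linComb-cong (reflexive ∘ ++-split {a = a} c) (λ _ → ≋-refl)) (linComb-++ _ _ b b')

    linComb-δ : ∀ {d} j (b : Fin d → V n) → linComb (δ j) b ≋ b j
    linComb-δ {suc d} j b t = begin
      linComb (δ j) b t
        ≈⟨ linComb-removeAt (δ j) b j t ⟩
      δ j j * b j t + linComb (removeAt (δ j) j) (removeAt b j) t
        ≈⟨ +-cong (*-congʳ (δ-diagonal j)) (linComb-cong (δ-punchIn j) (λ _ → ≋-refl) t) ⟩
      1# * b j t + linComb (const 0#) (removeAt b j) t
        ≈⟨ +-cong (*-identityˡ _) (linComb-zeroˡ (removeAt b j) t) ⟩
      b j t + 0#
        ≈⟨ +-identityʳ _ ⟩
      b j t
        ∎
      where open import Relation.Binary.Reasoning.Setoid setoid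

    linComb-scalars : ∀ {d} (c : Fin d → Carrier) (s : Fin d → V 1) (v : V n) →
                      linComb c (λ j → s j zero ⊙ v) ≋ linComb c s zero ⊙ v
    linComb-scalars {zero} c s v t = sym (zeroˡ _)
    linComb-scalars {suc d} c s v t = trans (+-congˡ (linComb-scalars (c ∘ suc) (s ∘ suc) v t))
      (solve 4 (λ x y z w → x :* (y :* z) :+ w :* z := (x :* y :+ w) :* z) refl
         (c zero) (s zero zero) (v t) (linComb (c ∘ suc) (s ∘ suc) zero))

  linComb-standardBasis : ∀ {n} (c : V n) → linComb c δ ≋ c
  linComb-standardBasis {suc n} c t = begin
    linComb c δ t
      ≈⟨ linComb-removeAt c δ t t ⟩
    c t * δ t t + linComb (removeAt c t) (removeAt δ t) t
      ≈⟨ +-cong (*-congˡ (δ-diagonal t))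
           (linComb-vanishesAt _ t (λ j → δ-offDiagonal (punchIn t j) t (Finₚ.punchInᵢ≢i t j))) ⟩
    c t * 1# + 0#
      ≈⟨ trans (+-identityʳ _) (*-identityʳ _) ⟩
    c t
      ∎
    where open import Relation.Binary.Reasoning.Setoid setoid

module LinearAlgebra (K : CommutativeRing 0ℓ 0ℓ) (K-isField : IsField K)
                     (_≟_ : Decidable (CommutativeRing._≈_ K)) where
  open CommutativeRing K hiding (zero)
  open Vectors K
  open import Algebra.Solver.Ring.NaturalCoefficients.Default commutativeSemiring
    using (solve; _:=_; _:+_; _:*_)
  open import Algebra.Properties.Ring ring
    using (-1*x≈-x; -‿distribˡ-*; -‿distribʳ-*; -‿involutive; +-inverseʳ-unique; x∙y⁻¹≈ε⇒x≈y)
  open import Relation.Binary.Reasoning.Setoid setoid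

  1≉0 : ¬ 1# ≈ 0#
  1≉0 = proj₁ K-isField

  x*y≈0⇒y≈0 : ∀ {x y} → ¬ x ≈ 0# → x * y ≈ 0# → y ≈ 0#
  x*y≈0⇒y≈0 {x} {y} x≉0 xy≈0 = begin
    y             ≈⟨ *-identityˡ y ⟨
    1# * y        ≈⟨ *-congʳ x⁻¹x≈1 ⟨
    x⁻¹ * x * y   ≈⟨ *-assoc x⁻¹ x y ⟩
    x⁻¹ * (x * y) ≈⟨ *-congˡ xy≈0 ⟩
    x⁻¹ * 0#      ≈⟨ zeroʳ x⁻¹ ⟩
    0#            ∎
    where
    x⁻¹ : Carrier
    x⁻¹ = proj₁ (proj₂ K-isField x x≉0)
    x⁻¹x≈1 : x⁻¹ * x ≈ 1#
    x⁻¹x≈1 = trans (*-comm x⁻¹ x) (proj₂ (proj₂ K-isField x x≉0))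

  insertAt⁺ : ∀ (Q : Carrier → Set) {n} {c : Fin n → Carrier} {x} → All Q c → Q x → ∀ i → All Q (insertAt c i x)
  insertAt⁺ Q Qc Qx zero zero = Qx
  insertAt⁺ Q Qc Qx zero (suc j) = Qc j
  insertAt⁺ Q {suc n} Qc Qx (suc i) zero = Qc zero
  insertAt⁺ Q {suc n} Qc Qx (suc i) (suc j) = insertAt⁺ Q (Qc ∘ suc) Qx i j

  module OverSubfield (P : Carrier → Set) (P-isSubfield : IsSubfield K P) where
    P-resp : ∀ {x y} → x ≈ y → P x → P y
    P-resp = proj₁ P-isSubfield

    P-0 : P 0#
    P-0 = proj₁ (proj₂ P-isSubfield)

    P-1 : P 1#
    P-1 = proj₁ (proj₂ (proj₂ P-isSubfield))

    P-+ : ∀ {x y} → P x → P y → P (x + y)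
    P-+ = proj₁ (proj₂ (proj₂ (proj₂ P-isSubfield)))

    P-neg : ∀ {x} → P x → P (- x)
    P-neg = proj₁ (proj₂ (proj₂ (proj₂ (proj₂ P-isSubfield))))

    P-* : ∀ {x y} → P x → P y → P (x * y)
    P-* = proj₁ (proj₂ (proj₂ (proj₂ (proj₂ (proj₂ P-isSubfield)))))

    P-inverse : ∀ {x} → P x → ¬ x ≈ 0# → Σ Carrier λ y → P y × x * y ≈ 1#
    P-inverse {x} Px x≉0 = let (y , xy≈1) = proj₂ K-isField x x≉0 in
      y , proj₂ (proj₂ (proj₂ (proj₂ (proj₂ (proj₂ P-isSubfield))))) Px xy≈1 , xy≈1

    card>1 : ∀ {q} → HasCard K P q → 1 ℕ.< q
    card>1 {zero} (_ , _ , _ , element-surjective) = ⊥-elim (Finₚ.¬Fin0 (proj₁ (element-surjective 0# P-0)))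
    card>1 {suc zero} (_ , _ , _ , element-surjective) with element-surjective 0# P-0 | element-surjective 1# P-1
    ... | zero , e≈0 | zero , e≈1 = ⊥-elim (1≉0 (trans (sym e≈1) e≈0))
    card>1 {suc (suc q)} _ = s≤s (s≤s z≤n)

    δ-∈P : ∀ {n} (i : Fin n) → All P (δ i)
    δ-∈P {suc n} i = insertAt⁺ P (λ _ → P-0) P-1 i

    linComb-∈P : ∀ {d n} {c : Fin d → Carrier} {b : Fin d → V n} →
                 All P c → ∀ t → (∀ j → P (b j t)) → P (linComb c b t)
    linComb-∈P {zero} Pc t Pb = P-0
    linComb-∈P {suc d} Pc t Pb = P-+ (P-* (Pc zero) (Pb zero)) (linComb-∈P (Pc ∘ suc) t (Pb ∘ suc))

    Span : ∀ {d n} → (Fin d → V n) → V n → Set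
    Span b v = Σ (Fin _ → Carrier) λ c → All P c × linComb c b ≋ v

    Independent : ∀ {d n} → (Fin d → V n) → Set
    Independent b = ∀ c → All P c → linComb c b ≋ 𝟘 → ∀ j → c j ≈ 0#

    module Subspace {n} {S : V n → Set} (S-isSubspace : IsSubspace K P S) where
      resp : ∀ {u v} → u ≋ v → S u → S v
      resp = proj₁ S-isSubspace

      ∋-𝟘 : S 𝟘
      ∋-𝟘 = proj₁ (proj₂ S-isSubspace)

      ∋-⊞ : ∀ {u v} → S u → S v → S (u ⊞ v)
      ∋-⊞ = proj₁ (proj₂ (proj₂ S-isSubspace))

      ∋-⊙ : ∀ {a v} → P a → S v → S (a ⊙ v)
      ∋-⊙ = proj₂ (proj₂ (proj₂ S-isSubspace))

      ∋-linComb : ∀ {d} {c : Fin d → Carrier} {b : Fin d → V n} → All P c → (∀ j → S (b j)) → S (linComb c b)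
      ∋-linComb {zero} Pc Sb = ∋-𝟘
      ∋-linComb {suc d} Pc Sb = ∋-⊞ (∋-⊙ (Pc zero) (Sb zero)) (∋-linComb (Pc ∘ suc) (Sb ∘ suc))

      ∋-span : ∀ {d} {b : Fin d → V n} → (∀ j → S (b j)) → ∀ {v} → Span b v → S v
      ∋-span Sb (c , Pc , c≋v) = resp c≋v (∋-linComb Pc Sb)

      ∋-cancelˡ : ∀ {s t v} → S s → S v → v ≋ s ⊞ t → S t
      ∋-cancelˡ {s} {t} {v} Ss Sv v≋s+t = resp t≋ (∋-⊞ Sv (∋-⊙ (P-neg P-1) Ss))
        where
        t≋ : v ⊞ (- 1#) ⊙ s ≋ t
        t≋ z = begin
          v z + - 1# * s z         ≈⟨ +-cong (v≋s+t z) (-1*x≈-x (s z)) ⟩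
          s z + t z + - s z        ≈⟨ +-congʳ (+-comm (s z) (t z)) ⟩
          t z + s z + - s z        ≈⟨ +-assoc (t z) (s z) (- s z) ⟩
          t z + (s z + - s z)      ≈⟨ +-congˡ (-‿inverseʳ (s z)) ⟩
          t z + 0#                 ≈⟨ +-identityʳ (t z) ⟩
          t z                      ∎

    module Basis {n} {S : V n → Set} {d} (S-dim : HasDim K P S d) where
      vectors : Fin d → V n
      vectors = proj₁ S-dim

      ∈S : ∀ j → S (vectors j)
      ∈S = proj₁ (proj₂ S-dim)

      independent : Independent vectors
      independent = proj₁ (proj₂ (proj₂ S-dim))

      spans : ∀ {v} → S v → Span vectors v
      spans = proj₂ (proj₂ (proj₂ S-dim)) _

    module _ {d n} {b : Fin d → V n} where
      span-resp : ∀ {u v} → u ≋ v → Span b u → Span b v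
      span-resp u≋v (c , Pc , b≋u) = c , Pc , ≋-trans b≋u u≋v

      span-𝟘 : Span b 𝟘
      span-𝟘 = const 0# , (λ _ → P-0) , linComb-zeroˡ b

      span-⊞ : ∀ {u v} → Span b u → Span b v → Span b (u ⊞ v)
      span-⊞ (c , Pc , c≋u) (c' , Pc' , c'≋v) =
        (λ j → c j + c' j) , (λ j → P-+ (Pc j) (Pc' j)) ,
        ≋-trans (linComb-+ c c' b) (λ t → +-cong (c≋u t) (c'≋v t))

      span-⊙ : ∀ {a v} → P a → Span b v → Span b (a ⊙ v)
      span-⊙ {a} Pa (c , Pc , c≋v) =
        (λ j → a * c j) , (λ j → P-* Pa (Pc j)) , ≋-trans (linComb-* a c b) (λ t → *-congˡ (c≋v t))

      span-linComb : ∀ {d'} {c : Fin d' → Carrier} {vs : Fin d' → V n} →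
                     All P c → (∀ j → Span b (vs j)) → Span b (linComb c vs)
      span-linComb {zero} Pc vs⊆ = span-𝟘
      span-linComb {suc d'} Pc vs⊆ = span-⊞ (span-⊙ (Pc zero) (vs⊆ zero)) (span-linComb (Pc ∘ suc) (vs⊆ ∘ suc))

      span-member : ∀ j → Span b (b j)
      span-member j = δ j , δ-∈P j , linComb-δ j b

      span-∷ : ∀ {u v} → Span b u → Span (v ∷ b) u
      span-∷ (c , Pc , c≋u) = (0# ∷ c) , (λ { zero → P-0 ; (suc j) → Pc j }) ,
        λ t → trans (+-cong (zeroˡ _) (c≋u t)) (+-identityˡ _)

      span-++ : ∀ {d'} {b' : Fin d' → V n} {u v} → Span b u → Span b' v → Span (b ++ b') (u ⊞ v)
      span-++ {b' = b'} (c , Pc , c≋u) (c' , Pc' , c'≋v) =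
        c ++ c' , ++⁺ P Pc Pc' , ≋-trans (linComb-++ c c' b b') (λ t → +-cong (c≋u t) (c'≋v t))

      span-subfamily : ∀ {d'} {vs : Fin d' → V n} → (∀ j → Span b (vs j)) → ∀ {u} → Span vs u → Span b u
      span-subfamily vs⊆ (c , Pc , c≋u) = span-resp c≋u (span-linComb Pc vs⊆)

      span-cong : ∀ {b' : Fin d → V n} → (∀ j → b j ≋ b' j) → ∀ {u} → Span b u → Span b' u
      span-cong b≋b' (c , Pc , c≋u) = c , Pc , ≋-trans (linComb-cong (λ _ → refl) (≋-sym ∘ b≋b')) c≋u

      independent-cong : ∀ {b' : Fin d → V n} → (∀ j → b j ≋ b' j) → Independent b → Independent b'
      independent-cong b≋b' b-ind c Pc c≋0 = b-ind c Pc (≋-trans (linComb-cong (λ _ → refl) b≋b') c≋0)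

      independent-∷ : ∀ {v} → Independent b → ¬ Span b v → Independent (v ∷ b)
      independent-∷ {v} b-ind v∉ c Pc c≋0 with c zero ≟ 0#
      ... | yes c₀≈0 = λ { zero → c₀≈0 ; (suc j) → b-ind (c ∘ suc) (Pc ∘ suc) tail≋0 j }
        where
        tail≋0 : linComb (c ∘ suc) b ≋ 𝟘
        tail≋0 t = trans (sym (trans (+-congʳ (trans (*-congʳ c₀≈0) (zeroˡ _))) (+-identityˡ _))) (c≋0 t)
      ... | no c₀≉0 = ⊥-elim (v∉ (span-resp v≋ (span-⊙ (P-neg Pι) (c ∘ suc , Pc ∘ suc , ≋-refl))))
        where
        ι : Carrier
        ι = proj₁ (P-inverse (Pc zero) c₀≉0)
        Pι : P ι
        Pι = proj₁ (proj₂ (P-inverse (Pc zero) c₀≉0))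
        c₀ι≈1 : c zero * ι ≈ 1#
        c₀ι≈1 = proj₂ (proj₂ (P-inverse (Pc zero) c₀≉0))
        v≋ : - ι ⊙ linComb (c ∘ suc) b ≋ v
        v≋ t = begin
          - ι * L             ≈⟨ -‿distribˡ-* ι L ⟨
          - (ι * L)           ≈⟨ -‿cong (*-congˡ (+-inverseʳ-unique _ _ (c≋0 t))) ⟩
          - (ι * - (c₀ * v t)) ≈⟨ -‿cong (-‿distribʳ-* ι _) ⟨
          - - (ι * (c₀ * v t)) ≈⟨ -‿involutive _ ⟩
          ι * (c₀ * v t)      ≈⟨ *-assoc ι c₀ (v t) ⟨
          ι * c₀ * v t        ≈⟨ *-congʳ (trans (*-comm ι c₀) c₀ι≈1) ⟩
          1# * v t            ≈⟨ *-identityˡ (v t) ⟩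
          v t                 ∎
          where
          L = linComb (c ∘ suc) b t
          c₀ = c zero

    standardBasis-spans : ∀ {n} {v : V n} → All P v → Span δ v
    standardBasis-spans {v = v} Pv = v , Pv , linComb-standardBasis v

    span-tail : ∀ {d n} {b : Fin (suc d) → V n} {v} → ((c , _ , _) : Span b v) → c zero ≈ 0# → Span (b ∘ suc) v
    span-tail (c , Pc , c≋v) c₀≈0 =
      c ∘ suc , Pc ∘ suc , λ t → trans (sym (trans (+-congʳ (trans (*-congʳ c₀≈0) (zeroˡ _))) (+-identityˡ _))) (c≋v t)

    module Elimination {p n N} {vs : Fin (suc n) → V N} {ws : Fin (suc p) → V N}
                       (vs⊆ : ∀ j → Span ws (vs j)) (j₀ : Fin (suc n)) (a₀≉0 : ¬ proj₁ (vs⊆ j₀) zero ≈ 0#) where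
      a : Fin (suc n) → Fin (suc p) → Carrier
      a j = proj₁ (vs⊆ j)

      Pa : ∀ j → All P (a j)
      Pa j = proj₁ (proj₂ (vs⊆ j))

      private
        inverse = P-inverse (Pa j₀ zero) a₀≉0

      ι : Carrier
      ι = proj₁ inverse

      μ : Fin n → Carrier
      μ j = - (a (punchIn j₀ j) zero * ι)

      P-μ : All P μ
      P-μ j = P-neg (P-* (Pa _ zero) (proj₁ (proj₂ inverse)))

      reduced : Fin n → V N
      reduced j = vs (punchIn j₀ j) ⊞ μ j ⊙ vs j₀

      head-cancels : ∀ j → a (punchIn j₀ j) zero + μ j * a j₀ zero ≈ 0#
      head-cancels j = begin
        x + - (x * ι) * a j₀ zero   ≈⟨ +-congˡ (-‿distribˡ-* _ _) ⟨
        x + - (x * ι * a j₀ zero)   ≈⟨ +-congˡ (-‿cong (*-assoc x ι _)) ⟩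
        x + - (x * (ι * a j₀ zero)) ≈⟨ +-congˡ (-‿cong (*-congˡ (trans (*-comm ι _) a₀ι≈1))) ⟩
        x + - (x * 1#)              ≈⟨ +-congˡ (-‿cong (*-identityʳ x)) ⟩
        x + - x                     ≈⟨ -‿inverseʳ x ⟩
        0#                          ∎
        where
        x = a (punchIn j₀ j) zero
        a₀ι≈1 : a j₀ zero * ι ≈ 1#
        a₀ι≈1 = proj₂ (proj₂ inverse)

      reduced⊆ : ∀ j → Span (ws ∘ suc) (reduced j)
      reduced⊆ j = e , (λ l → P-+ (Pa j' (suc l)) (P-* (P-μ j) (Pa j₀ (suc l)))) , e≋
        where
        j' = punchIn j₀ j
        e : Fin p → Carrier
        e l = a j' (suc l) + μ j * a j₀ (suc l)
        e≋ : linComb e (ws ∘ suc) ≋ reduced j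
        e≋ t = begin
          linComb e (ws ∘ suc) t
            ≈⟨ trans (linComb-+ (a j' ∘ suc) _ (ws ∘ suc) t) (+-congˡ (linComb-* (μ j) (a j₀ ∘ suc) (ws ∘ suc) t)) ⟩
          L' + μ j * L₀
            ≈⟨ trans (+-congˡ (trans (*-congʳ (head-cancels j)) (zeroˡ (ws zero t)))) (+-identityʳ _) ⟨
          L' + μ j * L₀ + (a j' zero + μ j * a j₀ zero) * ws zero t
            ≈⟨ solve 6 (λ L' m L₀ x y w → L' :+ m :* L₀ :+ (x :+ m :* y) :* w := x :* w :+ L' :+ m :* (y :* w :+ L₀)) refl
                 L' (μ j) L₀ (a j' zero) (a j₀ zero) (ws zero t) ⟩
          linComb (a j') ws t + μ j * linComb (a j₀) ws t
            ≈⟨ +-cong (proj₂ (proj₂ (vs⊆ j')) t) (*-congˡ (proj₂ (proj₂ (vs⊆ j₀)) t)) ⟩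
          reduced j t
            ∎
          where
          L' = linComb (a j' ∘ suc) (ws ∘ suc) t
          L₀ = linComb (a j₀ ∘ suc) (ws ∘ suc) t

      reduced-independent : Independent vs → Independent reduced
      reduced-independent vs-ind c Pc c≋0 j =
        trans (sym (reflexive (insertAt-punchIn c j₀ x j)))
              (vs-ind (insertAt c j₀ x) (insertAt⁺ P Pc Px j₀) lifted (punchIn j₀ j))
        where
        x = linComb c (λ j → const (μ j)) zero
        Px : P x
        Px = linComb-∈P Pc zero P-μ
        lifted : linComb (insertAt c j₀ x) vs ≋ 𝟘
        lifted t = begin
          linComb (insertAt c j₀ x) vs t
            ≈⟨ linComb-removeAt (insertAt c j₀ x) vs j₀ t ⟩
          insertAt c j₀ x j₀ * vs j₀ t + linComb (removeAt (insertAt c j₀ x) j₀) (removeAt vs j₀) t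
            ≈⟨ +-cong (*-congʳ (reflexive (insertAt-lookup c j₀ x)))
                      (linComb-cong (reflexive ∘ insertAt-punchIn c j₀ x) (λ _ → ≋-refl) t) ⟩
          x * vs j₀ t + linComb c (removeAt vs j₀) t
            ≈⟨ +-comm _ _ ⟩
          linComb c (removeAt vs j₀) t + x * vs j₀ t
            ≈⟨ +-congˡ (linComb-scalars c (λ j → const (μ j)) (vs j₀) t) ⟨
          linComb c (removeAt vs j₀) t + linComb c (λ j → μ j ⊙ vs j₀) t
            ≈⟨ linComb-⊞ c (removeAt vs j₀) _ t ⟨
          linComb c reduced t
            ≈⟨ c≋0 t ⟩
          0#
            ∎

    -- Steinitz: if some vs j₀ has a nonzero coefficient on ws zero, the other vectors reduced by it
    -- are still independent and lie in the span of the remaining p vectors; otherwise all vs do.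
    independent⇒≤ : ∀ {p n N} {vs : Fin n → V N} {ws : Fin p → V N} →
                    Independent vs → (∀ j → Span ws (vs j)) → n ≤ p
    independent⇒≤ {n = zero} _ _ = z≤n
    independent⇒≤ {zero} {suc n} {vs = vs} vs-ind vs⊆ =
      ⊥-elim (1≉0 (trans (sym (δ-diagonal {suc n} zero)) (vs-ind (δ zero) (δ-∈P zero) δ₀≋0 zero)))
      where
      δ₀≋0 : linComb (δ zero) vs ≋ 𝟘
      δ₀≋0 = ≋-trans (linComb-δ zero vs) (≋-sym (proj₂ (proj₂ (vs⊆ zero))))
    independent⇒≤ {suc p} {suc n} {vs = vs} {ws} vs-ind vs⊆ with Finₚ.any? (λ j → ¬? (proj₁ (vs⊆ j) zero ≟ 0#))
    ... | yes (j₀ , a₀≉0) = s≤s (independent⇒≤ (reduced-independent vs-ind) reduced⊆)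
      where open Elimination {vs = vs} {ws} vs⊆ j₀ a₀≉0
    ... | no none = ℕₚ.m≤n⇒m≤1+n (independent⇒≤ vs-ind (λ j → span-tail {b = ws} (vs⊆ j) (head≈0 j)))
      where
      head≈0 : ∀ j → proj₁ (vs⊆ j) zero ≈ 0#
      head≈0 j with proj₁ (vs⊆ j) zero ≟ 0#
      ... | yes a≈0 = a≈0
      ... | no a≉0 = ⊥-elim (none (j , a≉0))

    coordinates-unique : ∀ {d n} {b : Fin d → V n} → Independent b → ∀ {c c'} → All P c → All P c' →
                         linComb c b ≋ linComb c' b → ∀ j → c j ≈ c' j
    coordinates-unique {b = b} b-ind {c} {c'} Pc Pc' c≋c' j =
      x∙y⁻¹≈ε⇒x≈y _ _ (b-ind (λ j → c j + - c' j) (λ j → P-+ (Pc j) (P-neg (Pc' j))) difference≋0 j)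
      where
      difference≋0 : linComb (λ j → c j + - c' j) b ≋ 𝟘
      difference≋0 t = begin
        linComb (λ j → c j + - c' j) b t           ≈⟨ linComb-+ c _ b t ⟩
        linComb c b t + linComb (λ j → - c' j) b t ≈⟨ +-cong (c≋c' t) (linComb-neg c' b t) ⟩
        linComb c' b t + - linComb c' b t          ≈⟨ -‿inverseʳ _ ⟩
        0#                                         ∎

    record IsLinear {n n'} (f : V n → V n') : Set where
      field
        cong   : ∀ {u v} → u ≋ v → f u ≋ f v
        homo-⊞ : ∀ u v → f (u ⊞ v) ≋ f u ⊞ f v
        homo-⊙ : ∀ {a} → P a → ∀ v → f (a ⊙ v) ≋ a ⊙ f v

      homo-𝟘 : f 𝟘 ≋ 𝟘
      homo-𝟘 = ≋-trans (cong (λ _ → sym (zeroˡ 0#))) (≋-trans (homo-⊙ P-0 𝟘) (λ _ → zeroˡ _))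

      homo-linComb : ∀ {d} {c : Fin d → Carrier} → All P c → (F : Fin d → V n) → f (linComb c F) ≋ linComb c (f ∘ F)
      homo-linComb {zero} Pc F = homo-𝟘
      homo-linComb {suc d} Pc F =
        ≋-trans (homo-⊞ _ _) (λ t → +-cong (homo-⊙ (Pc zero) (F zero) t) (homo-linComb (Pc ∘ suc) (F ∘ suc) t))

      vanishes-on-span : ∀ {d} {F : Fin d → V n} → (∀ j → f (F j) ≋ 𝟘) → ∀ {v} → Span F v → f v ≋ 𝟘
      vanishes-on-span F≋0 (c , Pc , c≋v) =
        ≋-trans (cong (≋-sym c≋v)) (≋-trans (homo-linComb Pc _) (linComb-zeroʳ c F≋0))

    ∘-isLinear : ∀ {n n' n''} {g : V n' → V n''} {f : V n → V n'} → IsLinear g → IsLinear f → IsLinear (g ∘ f)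
    ∘-isLinear g-lin f-lin = record
      { cong   = λ u≋v → G.cong (F.cong u≋v)
      ; homo-⊞ = λ u v → ≋-trans (G.cong (F.homo-⊞ u v)) (G.homo-⊞ _ _)
      ; homo-⊙ = λ Pa v → ≋-trans (G.cong (F.homo-⊙ Pa v)) (G.homo-⊙ Pa _)
      }
      where
      module G = IsLinear g-lin
      module F = IsLinear f-lin

    hasDim-resp : ∀ {n} {S T : V n → Set} {d} → (∀ v → S v → T v) → (∀ v → T v → S v) →
                  HasDim K P S d → HasDim K P T d
    hasDim-resp S⊆T T⊆S (b , Sb , b-ind , b-spans) =
      b , (λ j → S⊆T _ (Sb j)) , b-ind , λ v Tv → b-spans v (T⊆S v Tv)

    independent-++ : ∀ {a b n} {E : Fin a → V n} {G : Fin b → V n} → Independent E → Independent G →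
                     (∀ {u v} → Span E u → Span G v → u ⊞ v ≋ 𝟘 → v ≋ 𝟘) → Independent (E ++ G)
    independent-++ {a} {b} {E = E} {G} E-ind G-ind trivial c Pc c≋0 j =
      ≡.subst (_≈ 0#) (≡.sym (++-split {a = a} c j)) (++⁺ (_≈ 0#) cE≈0 cG≈0 j)
      where
      A = linComb (c ∘ (_↑ˡ b)) E
      B = linComb (c ∘ (a ↑ʳ_)) G
      A+B≋0 : A ⊞ B ≋ 𝟘
      A+B≋0 = ≋-trans (≋-sym (linComb-split c E G)) c≋0
      B≋0 : B ≋ 𝟘
      B≋0 = trivial (_ , Pc ∘ (_↑ˡ b) , ≋-refl) (_ , Pc ∘ (a ↑ʳ_) , ≋-refl) A+B≋0
      cG≈0 : ∀ j → c (a ↑ʳ j) ≈ 0#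
      cG≈0 = G-ind _ (Pc ∘ (a ↑ʳ_)) B≋0
      cE≈0 : ∀ j → c (j ↑ˡ b) ≈ 0#
      cE≈0 = E-ind _ (Pc ∘ (_↑ˡ b)) λ t → trans (sym (trans (+-congˡ (B≋0 t)) (+-identityʳ _))) (A+B≋0 t)

    nullity+rank≤dim : ∀ {n n' d w a} {f : V n → V n'} {U N : V n → Set} {G : Fin a → V n} → IsLinear f →
                       HasDim K P U d → HasDim K P (_∩_ K U N) w → (∀ v → N v → f v ≋ 𝟘) →
                       (∀ j → U (G j)) → Independent (f ∘ G) → w ℕ.+ a ≤ d
    nullity+rank≤dim {f = f} {U} {G = G} f-lin U-dim UN-dim N⊆ker UG fG-ind =
      independent⇒≤ (independent-++ E.independent G-ind trivial)
                    (λ j → Basis.spans U-dim (++⁺ U {E.vectors} (proj₁ ∘ E.∈S) UG j))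
      where
      module E = Basis UN-dim
      open IsLinear f-lin
      fE≋0 : ∀ j → f (E.vectors j) ≋ 𝟘
      fE≋0 j = N⊆ker _ (proj₂ (E.∈S j))
      G-ind : Independent G
      G-ind c Pc c≋0 = fG-ind c Pc (≋-trans (≋-sym (homo-linComb Pc G)) (≋-trans (cong c≋0) homo-𝟘))
      trivial : ∀ {u v} → Span E.vectors u → Span G v → u ⊞ v ≋ 𝟘 → v ≋ 𝟘
      trivial {u} {v} u∈ (c , Pc , c≋v) u+v≋0 =
        ≋-trans (≋-sym c≋v) (≋-trans (linComb-cong c≈0 (λ _ → ≋-refl)) (linComb-zeroˡ G))
        where
        fu≋0 : f u ≋ 𝟘
        fu≋0 = vanishes-on-span fE≋0 u∈
        fv≋0 : f v ≋ 𝟘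
        fv≋0 t = begin
          f v t         ≈⟨ +-identityˡ _ ⟨
          0# + f v t    ≈⟨ +-congʳ (fu≋0 t) ⟨
          f u t + f v t ≈⟨ homo-⊞ u v t ⟨
          f (u ⊞ v) t   ≈⟨ ≋-trans (cong u+v≋0) homo-𝟘 t ⟩
          0#            ∎
        c≈0 : ∀ j → c j ≈ 0#
        c≈0 = fG-ind c Pc (≋-trans (≋-sym (homo-linComb Pc G)) (≋-trans (cong c≋v) fv≋0))

    scaling-isLinear : ∀ {n} μ → IsLinear {n} (μ ⊙_)
    scaling-isLinear μ = record
      { cong   = λ u≋v t → *-congˡ (u≋v t)
      ; homo-⊞ = λ u v t → distribˡ μ (u t) (v t)
      ; homo-⊙ = λ {a} _ v t → solve 3 (λ μ a x → μ :* (a :* x) := a :* (μ :* x)) refl μ a (v t)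
      }

    agree-on-span : ∀ {d n n'} {f g : V n → V n'} {F : Fin d → V n} → IsLinear f → IsLinear g →
                    (∀ j → f (F j) ≋ g (F j)) → ∀ {v} → Span F v → f v ≋ g v
    agree-on-span {F = F} f-lin g-lin fF≋gF (c , Pc , c≋v) =
      ≋-trans (F.cong (≋-sym c≋v)) (≋-trans (F.homo-linComb Pc F)
        (≋-trans (linComb-cong (λ _ → refl) fF≋gF) (≋-trans (≋-sym (G.homo-linComb Pc F)) (G.cong c≋v))))
      where
      module F = IsLinear f-lin
      module G = IsLinear g-lin

    nonzero-entry : ∀ {n} {u : V n} → ¬ u ≋ 𝟘 → Σ (Fin n) λ t → ¬ u t ≈ 0#
    nonzero-entry {n} {u} = Finₚ.¬∀⟶∃¬ n _ (λ t → u t ≟ 0#)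

    independent-pair : ∀ {n μ} {u : V n} → ¬ P μ → ¬ u ≋ 𝟘 → Independent (u ∷ μ ⊙ u ∷ [])
    independent-pair {μ = μ} {u} μ∉P u≉0 c Pc c≋0 = coefficients≈0 (c₁ ≟ 0#)
      where
      t = proj₁ (nonzero-entry u≉0)
      c₀ = c zero
      c₁ = c (suc zero)
      c₀+c₁μ≈0 : c₀ + c₁ * μ ≈ 0#
      c₀+c₁μ≈0 = x*y≈0⇒y≈0 (proj₂ (nonzero-entry u≉0)) (begin
        u t * (c₀ + c₁ * μ)
          ≈⟨ solve 4 (λ x a b m → x :* (a :+ b :* m) := a :* x :+ b :* (m :* x)) refl (u t) c₀ c₁ μ ⟩
        c₀ * u t + c₁ * (μ * u t)        ≈⟨ +-congˡ (+-identityʳ _) ⟨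
        c₀ * u t + (c₁ * (μ * u t) + 0#) ≈⟨ c≋0 t ⟩
        0#                               ∎)
      coefficients≈0 : Dec (c₁ ≈ 0#) → ∀ j → c j ≈ 0#
      coefficients≈0 (yes c₁≈0) zero =
        trans (sym (trans (+-congˡ (trans (*-congʳ c₁≈0) (zeroˡ μ))) (+-identityʳ c₀))) c₀+c₁μ≈0
      coefficients≈0 (yes c₁≈0) (suc zero) = c₁≈0
      coefficients≈0 (no c₁≉0) = ⊥-elim (μ∉P (P-resp μ≈ (P-* (P-neg (Pc zero)) Pι)))
        where
        ι : Carrier
        ι = proj₁ (P-inverse (Pc (suc zero)) c₁≉0)
        Pι : P ι
        Pι = proj₁ (proj₂ (P-inverse (Pc (suc zero)) c₁≉0))
        c₁ι≈1 : c₁ * ι ≈ 1#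
        c₁ι≈1 = proj₂ (proj₂ (P-inverse (Pc (suc zero)) c₁≉0))
        μ≈ : - c₀ * ι ≈ μ
        μ≈ = begin
          - c₀ * ι       ≈⟨ *-congʳ (+-inverseʳ-unique c₀ _ c₀+c₁μ≈0) ⟨
          c₁ * μ * ι     ≈⟨ solve 3 (λ a m i → a :* m :* i := a :* i :* m) refl c₁ μ ι ⟩
          c₁ * ι * μ     ≈⟨ *-congʳ c₁ι≈1 ⟩
          1# * μ         ≈⟨ *-identityˡ μ ⟩
          μ              ∎

    independent-⊙ : ∀ {d n μ} {b : Fin d → V n} → ¬ μ ≈ 0# → Independent b → Independent (λ j → μ ⊙ b j)
    independent-⊙ {μ = μ} {b} μ≉0 b-ind c Pc c≋0 =
      b-ind c Pc λ t → x*y≈0⇒y≈0 μ≉0 (trans (sym (linComb-⊙ μ c b t)) (c≋0 t))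

    scattered-∩-multiple : ∀ {n μ} {S : V n → Set} → Scattered K P S → ¬ P μ →
                           ∀ {u} → S u → S (μ ⊙ u) → u ≋ 𝟘
    scattered-∩-multiple {μ = μ} {S} S-scattered μ∉P {u} Su Sμu with Finₚ.all? (λ t → u t ≟ 0#)
    ... | yes u≋0 = u≋0
    ... | no u≉0 = ⊥-elim (ℕₚ.1+n≰n
      (independent⇒≤ {ws = Basis.vectors ⟨u⟩-dim} (independent-pair μ∉P u≉0) (Basis.spans ⟨u⟩-dim ∘ pair∈)))
      where
      ⟨u⟩-dim : HasWeight K P S (span1 K u) 1
      ⟨u⟩-dim = S-scattered u Su u≉0
      pair∈ : ∀ j → (_∩_ K S (span1 K u)) ((u ∷ μ ⊙ u ∷ []) j)
      pair∈ zero = Su , 1# , λ t → sym (*-identityˡ (u t))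
      pair∈ (suc zero) = Sμu , μ , ≋-refl

    -- Scalar-valued maps are maps into V 1; K itself, as a P-space, is also V 1.
    module Coordinates {n d} (B-dim : HasDim K P {n} Unary.U d) where
      open Basis B-dim

      coordinates : V n → Fin d → Carrier
      coordinates v = proj₁ (spans {v} tt)

      coordinates-∈P : ∀ v → All P (coordinates v)
      coordinates-∈P v = proj₁ (proj₂ (spans {v} tt))

      coordinates-correct : ∀ v → linComb (coordinates v) vectors ≋ v
      coordinates-correct v = proj₂ (proj₂ (spans {v} tt))

      coordinates-≈ : ∀ {v c} → All P c → linComb c vectors ≋ v → ∀ j → coordinates v j ≈ c j
      coordinates-≈ {v} Pc c≋v =
        coordinates-unique independent (coordinates-∈P v) Pc (≋-trans (coordinates-correct v) (≋-sym c≋v))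

      coordinate : Fin d → V n → V 1
      coordinate j v = const (coordinates v j)

      coordinate-isLinear : ∀ j → IsLinear (coordinate j)
      coordinate-isLinear j = record
        { cong   = λ {u} u≋v _ → sym (coordinates-≈ (coordinates-∈P u) (≋-trans (coordinates-correct u) u≋v) j)
        ; homo-⊞ = λ u v _ → coordinates-≈ (λ j → P-+ (coordinates-∈P u j) (coordinates-∈P v j))
            (≋-trans (linComb-+ _ _ vectors) (λ t → +-cong (coordinates-correct u t) (coordinates-correct v t))) j
        ; homo-⊙ = λ {a} Pa v _ → coordinates-≈ (λ j → P-* Pa (coordinates-∈P v j))
            (≋-trans (linComb-* a _ vectors) (λ t → *-congˡ (coordinates-correct v t))) j
        }

      coordinate-basis : ∀ i j → coordinates (vectors i) j ≈ δ i j
      coordinate-basis i = coordinates-≈ (δ-∈P i) (linComb-δ i vectors)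

    module Finite {q} (P-card : HasCard K P q) where
      private
        element : Fin q → Carrier
        element = proj₁ P-card

        element-surjective : ∀ {x} → P x → Σ (Fin q) λ i → element i ≈ x
        element-surjective Px = proj₂ (proj₂ (proj₂ P-card)) _ Px

      coefficients : ∀ {d} → Fin (q ℕ.^ d) → Fin d → Carrier
      coefficients i = element ∘ Fin.finToFun i

      coefficients-∈P : ∀ {d} i → All P (coefficients {d} i)
      coefficients-∈P i j = proj₁ (proj₂ P-card) _

      coefficients-surjective : ∀ {d} {c : Fin d → Carrier} → All P c →
                                Σ (Fin (q ℕ.^ d)) λ i → ∀ j → coefficients i j ≈ c j
      coefficients-surjective Pc = Fin.funToFin index , λ j →
          trans (reflexive (≡.cong element (Finₚ.finToFun-funToFin index j))) (proj₂ (element-surjective (Pc j)))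
        where
        index = λ j → proj₁ (element-surjective (Pc j))

      span? : ∀ {d n} (b : Fin d → V n) v → Dec (Span b v)
      span? b v with Finₚ.any? (λ i → Finₚ.all? (λ t → linComb (coefficients i) b t ≟ v t))
      ... | yes (i , i≋v) = yes (coefficients i , coefficients-∈P i , i≋v)
      ... | no none = no λ (c , Pc , c≋v) →
        let (i , i≈c) = coefficients-surjective Pc in none (i , ≋-trans (linComb-cong i≈c (λ _ → ≋-refl)) c≋v)

      subspace? : ∀ {n d} {S : V n → Set} → IsSubspace K P S → HasDim K P S d → ∀ v → Dec (S v)
      subspace? S-sub S-dim v with span? (Basis.vectors S-dim) v
      ... | yes v∈ = yes (Subspace.∋-span S-sub (Basis.∈S S-dim) v∈)
      ... | no v∉ = no (v∉ ∘ Basis.spans S-dim)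

      independent⇒spanning : ∀ {n N} {vs ws : Fin n → V N} → Independent vs → (∀ j → Span ws (vs j)) →
                              ∀ {u} → Span ws u → Span vs u
      independent⇒spanning {vs = vs} vs-ind vs⊆ {u} u∈ with span? vs u
      ... | yes u∈vs = u∈vs
      ... | no u∉vs = ⊥-elim (ℕₚ.1+n≰n
        (independent⇒≤ {vs = u ∷ vs} (independent-∷ vs-ind u∉vs) λ { zero → u∈ ; (suc j) → vs⊆ j }))

      record Extension {N p n} (E : Fin p → V n) (vs : Fin N → V n) (Q : Fin N → Set) : Set where
        field
          size        : ℕ
          pick        : Fin size → Fin N
          picked-Q    : ∀ j → Q (pick j)
          independent : Independent ((vs ∘ pick) ++ E)
          spans       : ∀ j → Q j → Span ((vs ∘ pick) ++ E) (vs j)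

      extend : ∀ {N p n} {E : Fin p → V n} {Q : Fin N → Set} → (∀ j → Dec (Q j)) → Independent E →
               (vs : Fin N → V n) → Extension E vs Q
      extend {zero} Q? E-ind vs = record
        { size = 0 ; pick = [] ; picked-Q = λ () ; independent = E-ind ; spans = λ () }
      extend {suc N} {E = E} Q? E-ind vs with extend (Q? ∘ suc) E-ind (vs ∘ suc) | Q? zero
      ... | r | no ¬Q₀ = record
        { size = size ; pick = suc ∘ pick ; picked-Q = picked-Q ; independent = independent
        ; spans = λ { zero Q₀ → ⊥-elim (¬Q₀ Q₀) ; (suc j) → spans j } }
        where open Extension r
      ... | r | yes Q₀ with span? ((vs ∘ suc ∘ Extension.pick r) ++ E) (vs zero)
      ...   | yes v₀∈ = record
        { size = size ; pick = suc ∘ pick ; picked-Q = picked-Q ; independent = independent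
        ; spans = λ { zero _ → v₀∈ ; (suc j) → spans j } }
        where open Extension r
      ...   | no v₀∉ = record
        { size = suc size ; pick = zero ∷ suc ∘ pick ; picked-Q = λ { zero → Q₀ ; (suc j) → picked-Q j }
        ; independent = independent-cong (≋-reflexive ∘ family-∷) (independent-∷ {v = vs zero} independent v₀∉)
        ; spans = λ { zero _ → span-cong (≋-reflexive ∘ family-∷)
                                         (span-member {b = vs zero ∷ (vs ∘ suc ∘ pick) ++ E} zero)
                    ; (suc j) Qj → span-cong (≋-reflexive ∘ family-∷) (span-∷ (spans j Qj)) } }
        where
        open Extension r
        family-∷ : ∀ i → (vs zero ∷ (vs ∘ suc ∘ pick) ++ E) i ≡ ((vs ∘ (zero ∷ suc ∘ pick)) ++ E) i
        family-∷ zero = ≡.refl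
        family-∷ (suc i) = ≡.sym (++-tail (vs ∘ (zero ∷ suc ∘ pick)) E i)

      ∩-hasDim : ∀ {n d} {U S : V n → Set} → IsSubspace K P U → HasDim K P U d →
                 (∀ {u v} → u ≋ v → S u → S v) → (∀ v → Dec (S v)) → Σ ℕ λ w → HasDim K P (_∩_ K U S) w
      ∩-hasDim {d = d} {U} {S} U-sub U-dim S-resp S? =
        size ℕ.+ 0 , (combination ∘ pick) ++ [] , ++⁺ (_∩_ K U S) (λ j → U-combination _ , picked-Q j) (λ ()) ,
        independent , λ v (Uv , Sv) →
          let (c , Pc , c≋v) = Basis.spans U-dim Uv
              (i , i≈c) = coefficients-surjective Pc
              i≋v = ≋-trans (linComb-cong i≈c (λ _ → ≋-refl)) c≋v
          in span-resp i≋v (spans i (S-resp (≋-sym i≋v) Sv))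
        where
        combination : Fin (q ℕ.^ d) → V _
        combination i = linComb (coefficients i) (Basis.vectors U-dim)
        U-combination : ∀ i → U (combination i)
        U-combination i = Subspace.∋-linComb U-sub (coefficients-∈P i) (Basis.∈S U-dim)
        open Extension (extend {E = []} (S? ∘ combination) (λ _ _ _ ()) combination)

      field-hasDim : ∀ {N} → HasCard K (Full K) N → Σ ℕ λ d → HasDim K P {1} Unary.U d
      field-hasDim (scalar , _ , _ , scalar-surjective) =
        size ℕ.+ 0 , (constant ∘ pick) ++ [] , (λ _ → tt) , independent , λ v _ →
          span-resp (λ { zero → proj₂ (scalar-surjective (v zero) tt) })
                    (spans (proj₁ (scalar-surjective (v zero) tt)) tt)
        where
        constant = λ k (_ : Fin 1) → scalar k
        open Extension (extend {E = []} (λ _ → yes tt) (λ _ _ _ ()) constant)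

      coefficients-injective : ∀ {d} {i i' : Fin (q ℕ.^ d)} →
                               (∀ j → coefficients {d} i j ≈ coefficients i' j) → i ≡ i'
      coefficients-injective {d} {i} {i'} i≈i' = ≡.trans (≡.sym (Finₚ.funToFin-finToFin {d} {q} i))
        (≡.trans (funToFin-cong (λ j → proj₁ (proj₂ (proj₂ P-card)) _ _ (i≈i' j))) (Finₚ.funToFin-finToFin {d} {q} i'))

      -- A basis of d vectors identifies P^d with K, so q ^ d = q ^ m.
      field-dimension : ∀ {m} → 1 ℕ.< q → HasCard K (Full K) (q ℕ.^ m) → HasDim K P {1} Unary.U m
      field-dimension {m} 1<q K-card@(scalar , _ , scalar-injective , scalar-surjective) =
        ≡.subst (HasDim K P Unary.U) d≡m (proj₂ (field-hasDim K-card))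
        where
        d = proj₁ (field-hasDim K-card)
        module β = Basis (proj₂ (field-hasDim K-card))
        index : Carrier → Fin (q ℕ.^ m)
        index x = proj₁ (scalar-surjective x tt)
        expansion : ∀ k → Span β.vectors (λ _ → scalar k)
        expansion k = β.spans tt
        coordinates : Fin (q ℕ.^ m) → Fin d → Carrier
        coordinates k = proj₁ (expansion k)
        encode : Fin (q ℕ.^ d) → Fin (q ℕ.^ m)
        encode i = index (linComb (coefficients i) β.vectors zero)
        decode : Fin (q ℕ.^ m) → Fin (q ℕ.^ d)
        decode k = proj₁ (coefficients-surjective (proj₁ (proj₂ (expansion k))))
        encode-injective : ∀ {i i'} → encode i ≡ encode i' → i ≡ i'
        encode-injective {i} {i'} e = coefficients-injective {d} (coordinates-unique β.independent
          (coefficients-∈P {d} i) (coefficients-∈P {d} i')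
          λ { zero → trans (sym (proj₂ (scalar-surjective _ tt)))
                           (trans (reflexive (≡.cong scalar e)) (proj₂ (scalar-surjective _ tt))) })
        decode-injective : ∀ {k k'} → decode k ≡ decode k' → k ≡ k'
        decode-injective {k} {k'} e = scalar-injective k k' (begin
          scalar k                                ≈⟨ proj₂ (proj₂ (expansion k)) zero ⟨
          linComb (coordinates k) β.vectors zero  ≈⟨ linComb-cong same-coordinates (λ _ → ≋-refl) zero ⟩
          linComb (coordinates k') β.vectors zero ≈⟨ proj₂ (proj₂ (expansion k')) zero ⟩
          scalar k'                               ∎)
          where
          same-coordinates : ∀ j → coordinates k j ≈ coordinates k' j
          same-coordinates j = trans (sym (proj₂ (coefficients-surjective (proj₁ (proj₂ (expansion k)))) j))
            (trans (reflexive (≡.cong (λ i → coefficients i j) e))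
                   (proj₂ (coefficients-surjective (proj₁ (proj₂ (expansion k')))) j))
        d≡m : d ≡ m
        d≡m = ℕₚ.≤-antisym (^-cancelˡ-≤ 1<q (Finₚ.injective⇒≤ encode-injective))
                           (^-cancelˡ-≤ 1<q (Finₚ.injective⇒≤ decode-injective))

      dim≤rank+nullity : ∀ {n n' d w m} {f : V n → V n'} {U N : V n → Set} → IsLinear f → IsSubspace K P U →
                         HasDim K P U d → HasDim K P (_∩_ K U N) w → (∀ v → f v ≋ 𝟘 → N v) →
                         (T : Fin m → V n') → (∀ v → U v → Span T (f v)) → d ≤ m ℕ.+ w
      dim≤rank+nullity {w = w} {f = f} f-lin U-sub U-dim UN-dim ker⊆N T fU⊆T =
        ℕₚ.≤-trans (independent⇒≤ B.independent (λ j → spans j tt)) (ℕₚ.+-monoˡ-≤ w size≤m)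
        where
        module B = Basis U-dim
        module E = Basis UN-dim
        open IsLinear f-lin
        open Extension (extend {E = E.vectors} (λ _ → yes tt) E.independent B.vectors)
        G = B.vectors ∘ pick
        fG-independent : Independent (f ∘ G)
        fG-independent c Pc c≋0 j = trans (sym (reflexive (lookup-++ˡ c _ j)))
          (independent (c ++ c'-neg) (++⁺ P Pc (λ j → P-neg (Pc' j))) relation (j ↑ˡ w))
          where
          u = linComb c G
          Uu = Subspace.∋-linComb U-sub Pc (B.∈S ∘ pick)
          Nu = ker⊆N u (≋-trans (homo-linComb Pc G) c≋0)
          c' = proj₁ (E.spans (Uu , Nu))
          Pc' = proj₁ (proj₂ (E.spans (Uu , Nu)))
          c'≋u = proj₂ (proj₂ (E.spans (Uu , Nu)))
          c'-neg = λ j → - c' j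
          relation : linComb (c ++ c'-neg) (G ++ E.vectors) ≋ 𝟘
          relation t = begin
            linComb (c ++ c'-neg) (G ++ E.vectors) t ≈⟨ linComb-++ c c'-neg G E.vectors t ⟩
            u t + linComb c'-neg E.vectors t         ≈⟨ +-congˡ (trans (linComb-neg c' E.vectors t) (-‿cong (c'≋u t))) ⟩
            u t + - u t                              ≈⟨ -‿inverseʳ _ ⟩
            0#                                       ∎
        size≤m : size ≤ _
        size≤m = independent⇒≤ fG-independent (λ j → fU⊆T _ (B.∈S (pick j)))

      equal-dim-⊆⇒⊇ : ∀ {n d} {S T : V n → Set} → IsSubspace K P S → HasDim K P S d → HasDim K P T d →
                      (∀ v → S v → T v) → ∀ v → T v → S v
      equal-dim-⊆⇒⊇ S-sub S-dim T-dim S⊆T v Tv =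
        Subspace.∋-span S-sub S.∈S
          (independent⇒spanning S.independent (λ j → T.spans (S⊆T _ (S.∈S j))) (T.spans Tv))
        where
        module S = Basis S-dim
        module T = Basis T-dim

      module Pairing {m} (β-dim : HasDim K P {1} Unary.U m) {f : V 1 → V 1} (f-lin : IsLinear f)
                     {c} (fc≋1 : f c ≋ const 1#) where
        private
          module β = Basis β-dim
          module f = IsLinear f-lin

        pairing : V 1 → V m
        pairing ν j = f (ν zero ⊙ β.vectors j) zero

        pairing-isLinear : IsLinear pairing
        pairing-isLinear = record
          { cong   = λ u≋v j → f.cong (λ t → *-congʳ (u≋v zero)) zero
          ; homo-⊞ = λ u v j → trans (f.cong (λ t → distribʳ _ (u zero) (v zero)) zero) (f.homo-⊞ _ _ zero)
          ; homo-⊙ = λ Pa v j → trans (f.cong (λ t → *-assoc _ (v zero) _) zero) (f.homo-⊙ Pa _ zero)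
          }

        pairing-injective : ∀ {ν} → pairing ν ≋ 𝟘 → ν zero ≈ 0#
        pairing-injective {ν} pairing≋0 with ν zero ≟ 0#
        ... | yes ν₀≈0 = ν₀≈0
        ... | no ν₀≉0 = ⊥-elim (1≉0 (begin
          1#                          ≈⟨ fc≋1 zero ⟨
          f c zero                    ≈⟨ f.cong ν₀ι⊙c≋c zero ⟨
          f (ν zero ⊙ (ι ⊙ c)) zero   ≈⟨ vanishes zero ⟩
          0#                          ∎))
          where
          ι = proj₁ (proj₂ K-isField _ ν₀≉0)
          ν₀ι⊙c≋c : ν zero ⊙ (ι ⊙ c) ≋ c
          ν₀ι⊙c≋c t = begin
            ν zero * (ι * c t) ≈⟨ *-assoc _ _ _ ⟨
            ν zero * ι * c t   ≈⟨ *-congʳ (proj₂ (proj₂ K-isField _ ν₀≉0)) ⟩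
            1# * c t           ≈⟨ *-identityˡ _ ⟩
            c t                ∎
          vanishes : f (ν zero ⊙ (ι ⊙ c)) ≋ 𝟘
          vanishes = IsLinear.vanishes-on-span (∘-isLinear f-lin (scaling-isLinear (ν zero)))
                       (λ j → λ { zero → pairing≋0 j }) (β.spans {ι ⊙ c} tt)

        pairing-basis-independent : Independent (pairing ∘ β.vectors)
        pairing-basis-independent a Pa a≋0 = β.independent a Pa λ { zero → pairing-injective {linComb a β.vectors}
          (≋-trans (IsLinear.homo-linComb pairing-isLinear Pa β.vectors) a≋0) }

      -- pairing is an injective map between P-spaces of the same dimension m, so it is onto; a preimage μ
      -- of the values of g on β makes v ↦ f (μ ⊙ v) agree with g on β, hence everywhere.
      functional-multiplier : ∀ {m} → HasDim K P {1} Unary.U m → ∀ {f g : V 1 → V 1} → IsLinear f → IsLinear g →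
                              (∀ v → P (f v zero)) → (∀ v → P (g v zero)) → ∀ {c} → f c ≋ const 1# →
                              Σ Carrier λ μ → ∀ v → f (μ ⊙ v) ≋ g v
      functional-multiplier {m} β-dim {f} {g} f-lin g-lin f∈P g∈P fc≋1 =
        μ , λ v → agree-on-span (∘-isLinear f-lin (scaling-isLinear μ)) g-lin
                    (λ j → λ { zero → μ-represents j }) (Basis.spans β-dim {v} tt)
        where
        open Pairing β-dim f-lin fc≋1
        β : Fin m → V 1
        β = Basis.vectors β-dim

        preimage : Span (pairing ∘ β) (λ j → g (β j) zero)
        preimage = independent⇒spanning pairing-basis-independent
                     (λ j → standardBasis-spans (λ _ → f∈P _)) (standardBasis-spans (λ _ → g∈P _))

        μ : Carrier
        μ = linComb (proj₁ preimage) β zero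

        μ-represents : ∀ j → f (μ ⊙ β j) zero ≈ g (β j) zero
        μ-represents = ≋-trans (IsLinear.homo-linComb pairing-isLinear (proj₁ (proj₂ preimage)) β) (proj₂ (proj₂ preimage))

  Full-isSubfield : IsSubfield K (Full K)
  Full-isSubfield = (λ _ _ → tt) , tt , tt , (λ _ _ → tt) , (λ _ → tt) , (λ _ _ → tt) , (λ _ _ → tt)

  module K-linear = OverSubfield (Full K) Full-isSubfield

  scalarMultiples : ∀ {m r n} → (Fin m → V 1) → (Fin r → V n) → Fin (r ℕ.* m) → V n
  scalarMultiples {r = zero} β w = []
  scalarMultiples {r = suc r} β w = (λ a → β a zero ⊙ w zero) ++ scalarMultiples β (w ∘ suc)

  module RestrictScalars {P : Carrier → Set} (P-isSubfield : IsSubfield K P) where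
    open OverSubfield P P-isSubfield

    restrictScalars-isLinear : ∀ {n n'} {f : V n → V n'} → K-linear.IsLinear f → IsLinear f
    restrictScalars-isLinear f-lin = record { cong = F.cong ; homo-⊞ = F.homo-⊞ ; homo-⊙ = λ _ → F.homo-⊙ tt }
      where module F = K-linear.IsLinear f-lin

    restrictScalars-span : ∀ {m r n} {β : Fin m → V 1} {w : Fin r → V n} → (∀ v → Span β v) →
                           ∀ {v} → K-linear.Span w v → Span (scalarMultiples β w) v
    restrictScalars-span {r = zero} β-spans (c , _ , c≋v) = span-resp {b = []} c≋v (span-𝟘 {b = []})
    restrictScalars-span {r = suc r} {β = β} {w} β-spans (c , _ , c≋v) =
      span-resp c≋v (span-++ first (restrictScalars-span β-spans (c ∘ suc , _ , ≋-refl)))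
      where
      e = proj₁ (β-spans (const (c zero)))
      first : Span (λ a → β a zero ⊙ w zero) (c zero ⊙ w zero)
      first = e , proj₁ (proj₂ (β-spans _)) ,
        ≋-trans (linComb-scalars e β (w zero)) (λ t → *-congʳ (proj₂ (proj₂ (β-spans _)) zero))

    restrictScalars-≤ : ∀ {m r n d} {W : V n → Set} {vs : Fin d → V n} → HasDim K P {1} Unary.U m →
                        HasDim K (Full K) W r → Independent vs → (∀ j → W (vs j)) → d ≤ r ℕ.* m
    restrictScalars-≤ β-dim W-dim vs-ind W-vs = independent⇒≤ vs-ind λ j →
      restrictScalars-span (λ v → Basis.spans β-dim {v} tt) (K-linear.Basis.spans W-dim (W-vs j))

  module HyperplaneFunctional {N k'} (K-card : HasCard K (Full K) N) {Ω : V (suc k') → Set}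
                              (Ω-isSubspace : IsSubspace K (Full K) Ω) (Ω-dim : HasDim K (Full K) Ω k')
                              {y} (y∉Ω : ¬ Ω y) where
    open K-linear
    open Finite K-card
    private
      module Ω = Basis Ω-dim

      span⊆Ω : ∀ {v} → Span Ω.vectors v → Ω v
      span⊆Ω = Subspace.∋-span Ω-isSubspace Ω.∈S

      y∷Ω-independent : Independent (y ∷ Ω.vectors)
      y∷Ω-independent = independent-∷ {b = Ω.vectors} Ω.independent (y∉Ω ∘ span⊆Ω)

      y∷Ω-basis : HasDim K (Full K) Unary.U (suc k')
      y∷Ω-basis = y ∷ Ω.vectors , (λ _ → tt) , y∷Ω-independent ,
                  λ v _ → independent⇒spanning {vs = y ∷ Ω.vectors} {ws = δ} y∷Ω-independent
                            (λ _ → standardBasis-spans (λ _ → tt)) (standardBasis-spans (λ _ → tt))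

    open Coordinates y∷Ω-basis

    ψ : V (suc k') → V 1
    ψ = coordinate zero

    ψ-isLinear : IsLinear ψ
    ψ-isLinear = coordinate-isLinear zero

    Ω⊆ker-ψ : ∀ {v} → Ω v → ψ v ≋ 𝟘
    Ω⊆ker-ψ Ωv _ =
      let (c , Pc , c≋v) = span-∷ {b = Ω.vectors} {v = y} (Ω.spans Ωv) in coordinates-≈ {c = c} Pc c≋v zero

    ker-ψ⊆Ω : ∀ {v} → ψ v ≋ 𝟘 → Ω v
    ker-ψ⊆Ω {v} ψv≋0 = span⊆Ω (span-tail {b = y ∷ Ω.vectors} (Basis.spans y∷Ω-basis {v} tt) (ψv≋0 zero))

    ψ-y : ψ y ≋ const 1#
    ψ-y _ = trans (coordinate-basis zero zero) (δ-diagonal {suc k'} zero)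

module Configuration
  (K : CommutativeRing 0ℓ 0ℓ) (K-isField : IsField K)
  {q m k' h : ℕ} (k'm≡2h : k' ℕ.* m ≡ 2 ℕ.* h) (K-card : HasCard K (Full K) (q ℕ.^ m))
  {Fq : CommutativeRing.Carrier K → Set} (Fq-isSubfield : IsSubfield K Fq) (Fq-card : HasCard K Fq q)
  {W : Vect K (suc k') → Set} (W-isSubspace : IsSubspace K (Full K) W) (W-dim : HasDim K (Full K) W k')
  {U' : Vect K (suc k') → Set} (U'-isSubspace : IsSubspace K Fq U') (U'⊆W : _⊆_ K U' W)
  (U'-scattered : Scattered K Fq U') (U'-dim : HasDim K Fq U' h)
  {x : Vect K (suc k')} (x-transversal : ∀ v → span1 K x v → W v → _≈v_ K v (0v K))
  {i : ℕ} {U'' : Vect K (suc k') → Set} (U''-isSubspace : IsSubspace K Fq U'') (U''⊆⟨x⟩ : _⊆_ K U'' (span1 K x))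
  (U''-dim : HasDim K Fq U'' i)
  where

  open CommutativeRing K hiding (zero)
  open Vectors K
  open LinearAlgebra K K-isField (hasCard⇒decidable K K-card)
  open OverSubfield Fq Fq-isSubfield
  open Finite Fq-card
  open RestrictScalars Fq-isSubfield
  open import Relation.Binary.Reasoning.Setoid setoid

  private
    module U' = Basis U'-dim
    module U'' = Basis U''-dim
    module U'-subspace = Subspace U'-isSubspace
    module U''-subspace = Subspace U''-isSubspace
    module W = K-linear.Subspace W-isSubspace
    module W-basis = K-linear.Basis W-dim
    β-dim : HasDim K Fq {1} Unary.U m
    β-dim = field-dimension (card>1 Fq-card) K-card
    module β = Basis β-dim

  U : V (suc k') → Set
  U = _⊕_ K U' U''

  U-isSubspace : IsSubspace K Fq U
  U-isSubspace =
      (λ u≋v (s , t , U's , U''t , u≋s+t) → s , t , U's , U''t , ≋-trans (≋-sym u≋v) u≋s+t)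
    , (𝟘 , 𝟘 , U'-subspace.∋-𝟘 , U''-subspace.∋-𝟘 , λ _ → sym (+-identityʳ 0#))
    , (λ (s , t , U's , U''t , u≋s+t) (s' , t' , U's' , U''t' , v≋s'+t') →
         s ⊞ s' , t ⊞ t' , U'-subspace.∋-⊞ U's U's' , U''-subspace.∋-⊞ U''t U''t' ,
         λ z → trans (+-cong (u≋s+t z) (v≋s'+t' z))
                     (solve 4 (λ a b c d → a :+ b :+ (c :+ d) := a :+ c :+ (b :+ d)) refl _ _ _ _))
    , (λ {a} Fa (s , t , U's , U''t , v≋s+t) →
         a ⊙ s , a ⊙ t , U'-subspace.∋-⊙ Fa U's , U''-subspace.∋-⊙ Fa U''t ,
         λ z → trans (*-congˡ (v≋s+t z)) (distribˡ a (s z) (t z)))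
    where
    open import Algebra.Solver.Ring.NaturalCoefficients.Default commutativeSemiring using (solve; _:=_; _:+_)

  U'⊆U : ∀ {v} → U' v → U v
  U'⊆U {v} U'v = v , 𝟘 , U'v , U''-subspace.∋-𝟘 , λ _ → sym (+-identityʳ _)

  U''⊆U : ∀ {v} → U'' v → U v
  U''⊆U {v} U''v = 𝟘 , v , U'-subspace.∋-𝟘 , U''v , λ _ → sym (+-identityˡ _)

  U''∩W≋0 : ∀ {t} → U'' t → W t → t ≋ 𝟘
  U''∩W≋0 {t} U''t = x-transversal t (U''⊆⟨x⟩ t U''t)

  U-dim : HasDim K Fq U (h ℕ.+ i)
  U-dim = U'.vectors ++ U''.vectors , ++⁺ U (U'⊆U ∘ U'.∈S) (U''⊆U ∘ U''.∈S) ,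
          independent-++ U'.independent U''.independent U'∩U''≋0 ,
          λ v (s , t , U's , U''t , v≋s+t) → span-resp (≋-sym v≋s+t) (span-++ (U'.spans U's) (U''.spans U''t))
    where
    U'∩U''≋0 : ∀ {u v} → Span U'.vectors u → Span U''.vectors v → u ⊞ v ≋ 𝟘 → v ≋ 𝟘
    U'∩U''≋0 u∈ v∈ u+v≋0 = U''∩W≋0 (U''-subspace.∋-span U''.∈S v∈)
                                    (W.∋-cancelˡ (U'⊆W _ (U'-subspace.∋-span U'.∈S u∈)) W.∋-𝟘 (≋-sym u+v≋0))

  U∩W⊆U' : ∀ {v} → U v → W v → U' v
  U∩W⊆U' {v} (s , t , U's , U''t , v≋s+t) Wv =
    U'-subspace.resp (λ z → trans (sym (trans (+-congˡ (t≋0 z)) (+-identityʳ _))) (sym (v≋s+t z))) U's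
    where
    t≋0 : t ≋ 𝟘
    t≋0 = U''∩W≋0 U''t (W.∋-cancelˡ (U'⊆W s U's) Wv v≋s+t)

  WeightSpectrum : ℕ → Set
  WeightSpectrum w = (w ≡ h) ⊎ (((+ h) ℤ.- (+ m) ℤ.≤ (+ w)) × ((+ w) ℤ.≤ (+ h) ℤ.- (+ m) ℤ.+ (+ i) ℤ.+ (+ 1)))

  module Hyperplane {Ω : V (suc k') → Set} (Ω-isSubspace : IsSubspace K (Full K) Ω)
                    (Ω-dim : HasDim K (Full K) Ω k') where

    Ω? : ∀ v → Dec (Ω v)
    Ω? = K-linear.Finite.subspace? K-card Ω-isSubspace Ω-dim

    weight-exists : Σ ℕ λ w → HasWeight K Fq U Ω w
    weight-exists = ∩-hasDim U-isSubspace U-dim (K-linear.Subspace.resp Ω-isSubspace) Ω?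

    weight-⊇W : (∀ v → W v → Ω v) → HasWeight K Fq U Ω h
    weight-⊇W W⊆Ω = hasDim-resp (λ v U'v → U'⊆U U'v , W⊆Ω v (U'⊆W v U'v))
                                (λ v (Uv , Ωv) → U∩W⊆U' Uv (Ω⊆W v Ωv)) U'-dim
      where
      Ω⊆W : ∀ v → Ω v → W v
      Ω⊆W = K-linear.Finite.equal-dim-⊆⇒⊇ K-card W-isSubspace W-dim Ω-dim W⊆Ω

    module Transversal {y} (W∋y : W y) (y∉Ω : ¬ Ω y) where
      open HyperplaneFunctional K-card Ω-isSubspace Ω-dim y∉Ω

      ψ-Fq-linear : IsLinear ψ
      ψ-Fq-linear = restrictScalars-isLinear ψ-isLinear

      weight-lower-bound : ∀ {w} → HasWeight K Fq U Ω w → h ℕ.+ i ≤ m ℕ.+ w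
      weight-lower-bound UΩ-dim = dim≤rank+nullity ψ-Fq-linear U-isSubspace U-dim UΩ-dim (λ _ → ker-ψ⊆Ω) β.vectors
                                      (λ v _ → β.spans {ψ v} tt)

      module CodimensionTwo {a} {α : Fin a → V 1} (α-independent : Independent α)
                            (ψU'⊆α : ∀ {u} → U' u → Span α (ψ u)) (2+a≤m : 2 ℕ.+ a ≤ m) where
        open Extension (extend {E = α} (λ _ → yes tt) α-independent β.vectors)

        Bs-dim : HasDim K Fq {1} Unary.U (size ℕ.+ a)
        Bs-dim = _ , (λ _ → tt) , independent , λ v _ → span-subfamily (λ j → spans j tt) (β.spans {v} tt)

        module Bs = Basis Bs-dim
        open Coordinates Bs-dim

        2≤size : 2 ≤ size
        2≤size = ℕₚ.+-cancelʳ-≤ a 2 size (ℕₚ.≤-trans 2+a≤m (independent⇒≤ β.independent (λ j → spans j tt)))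

        ι₁ ι₂ : Fin (size ℕ.+ a)
        ι₁ = proj₁ (two-distinct 2≤size) ↑ˡ a
        ι₂ = proj₁ (proj₂ (two-distinct 2≤size)) ↑ˡ a

        ι₂≢ι₁ : ι₂ ≢ ι₁
        ι₂≢ι₁ e = proj₂ (proj₂ (two-distinct 2≤size)) (≡.sym (Finₚ.↑ˡ-injective a _ _ e))

        c₁ c₂ : V 1
        c₁ = Bs.vectors ι₁
        c₂ = Bs.vectors ι₂

        f₁ f₂ : V 1 → V 1
        f₁ = coordinate ι₁
        f₂ = coordinate ι₂

        f₁-isLinear : IsLinear f₁
        f₁-isLinear = coordinate-isLinear ι₁

        f₂-isLinear : IsLinear f₂
        f₂-isLinear = coordinate-isLinear ι₂

        f₁c₁≋1 : f₁ c₁ ≋ const 1#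
        f₁c₁≋1 _ = trans (coordinate-basis ι₁ ι₁) (δ-diagonal ι₁)

        f₂c₂≋1 : f₂ c₂ ≋ const 1#
        f₂c₂≋1 _ = trans (coordinate-basis ι₂ ι₂) (δ-diagonal ι₂)

        f₁c₂≋0 : f₁ c₂ ≋ 𝟘
        f₁c₂≋0 _ = trans (coordinate-basis ι₂ ι₁) (δ-offDiagonal ι₂ ι₁ ι₂≢ι₁)

        coordinate-ψU'≋0 : ∀ l → ∀ {u} → U' u → coordinate (l ↑ˡ a) (ψ u) ≋ 𝟘
        coordinate-ψU'≋0 l U'u = IsLinear.vanishes-on-span (coordinate-isLinear (l ↑ˡ a)) α≋0 (ψU'⊆α U'u)
          where
          α≋0 : ∀ j → coordinate (l ↑ˡ a) (α j) ≋ 𝟘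
          α≋0 j _ =
            trans (reflexive (≡.cong (λ v → coordinates v (l ↑ˡ a)) (≡.sym (lookup-++ʳ (β.vectors ∘ pick) α j))))
                  (trans (coordinate-basis (size ↑ʳ j) (l ↑ˡ a)) (δ-offDiagonal _ _ (↑ˡ≢↑ʳ l j ∘ ≡.sym)))

        multiplier : Σ Carrier λ μ → ∀ v → f₁ (μ ⊙ v) ≋ f₂ v
        multiplier = functional-multiplier β-dim (f₁-isLinear) (f₂-isLinear)
                                           (λ v → coordinates-∈P v ι₁) (λ v → coordinates-∈P v ι₂) f₁c₁≋1

        μ : Carrier
        μ = proj₁ multiplier

        μ∉Fq : ¬ Fq μ
        μ∉Fq Fμ = 1≉0 (begin
          1#                            ≈⟨ f₂c₂≋1 zero ⟨
          f₂ c₂ zero         ≈⟨ proj₂ multiplier c₂ zero ⟨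
          f₁ (μ ⊙ c₂) zero   ≈⟨ IsLinear.homo-⊙ (f₁-isLinear) Fμ c₂ zero ⟩
          μ * f₁ c₂ zero     ≈⟨ *-congˡ (f₁c₂≋0 zero) ⟩
          μ * 0#                        ≈⟨ zeroʳ μ ⟩
          0#                            ∎)

        θ : V (suc k') → V 1
        θ = f₁ ∘ ψ

        θ-isLinear : IsLinear θ
        θ-isLinear = ∘-isLinear (f₁-isLinear) ψ-Fq-linear

        θ-U' : ∀ {u} → U' u → θ u ≋ 𝟘
        θ-U' = coordinate-ψU'≋0 _

        θ-μU' : ∀ {u} → U' u → θ (μ ⊙ u) ≋ 𝟘
        θ-μU' {u} U'u = ≋-trans (IsLinear.cong (f₁-isLinear) (K-linear.IsLinear.homo-⊙ ψ-isLinear tt u))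
                                (≋-trans (proj₂ multiplier (ψ u)) (coordinate-ψU'≋0 _ U'u))

        z : V (suc k')
        z = c₁ zero ⊙ y

        θz≋1 : θ z ≋ const 1#
        θz≋1 = ≋-trans (IsLinear.cong (f₁-isLinear) ψz≋c₁) f₁c₁≋1
          where
          ψz≋c₁ : ψ z ≋ c₁
          ψz≋c₁ = ≋-trans (K-linear.IsLinear.homo-⊙ ψ-isLinear tt y)
                          λ { zero → trans (*-congˡ (ψ-y zero)) (*-identityʳ _) }

        μU' : Fin h → V (suc k')
        μU' l = μ ⊙ U'.vectors l

        U'∩μU'≋0 : ∀ {u v} → Span U'.vectors u → Span μU' v → u ⊞ v ≋ 𝟘 → v ≋ 𝟘
        U'∩μU'≋0 {v = v} u∈ (c' , Pc' , c'≋v) u+v≋0 =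
          ≋-trans v≋μu' (≋-trans (λ t → *-congˡ (u'≋0 t)) (λ _ → zeroʳ μ))
          where
          u' = linComb c' U'.vectors
          v≋μu' : v ≋ μ ⊙ u'
          v≋μu' = ≋-trans (≋-sym c'≋v) (linComb-⊙ μ c' U'.vectors)
          U'μu' : U' (μ ⊙ u')
          U'μu' = U'-subspace.∋-cancelˡ (U'-subspace.∋-span U'.∈S u∈) U'-subspace.∋-𝟘
                    (≋-trans (≋-sym u+v≋0) (λ t → +-congˡ (v≋μu' t)))
          u'≋0 : u' ≋ 𝟘
          u'≋0 = scattered-∩-multiple U'-scattered μ∉Fq (U'-subspace.∋-linComb Pc' U'.∈S) U'μu'

        family : Fin (suc (h ℕ.+ h)) → V (suc k')
        family = z ∷ U'.vectors ++ μU'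

        family-independent : Independent family
        family-independent = independent-∷ {b = U'.vectors ++ μU'}
          (independent-++ U'.independent (independent-⊙ μ≉0 U'.independent) U'∩μU'≋0)
          (λ z∈ → 1≉0 (trans (sym (θz≋1 zero))
                         (IsLinear.vanishes-on-span θ-isLinear
                           (++⁺ (λ v → θ v ≋ 𝟘) {U'.vectors} (θ-U' ∘ U'.∈S) (θ-μU' ∘ U'.∈S)) z∈ zero)))
          where
          μ≉0 : ¬ μ ≈ 0#
          μ≉0 μ≈0 = μ∉Fq (P-resp (sym μ≈0) P-0)

        family⊆W : ∀ j → W (family j)
        family⊆W zero = W.∋-⊙ tt W∋y
        family⊆W (suc j) = ++⁺ W (λ l → U'⊆W _ (U'.∈S l)) (λ l → W.∋-⊙ tt (U'⊆W _ (U'.∈S l))) j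

        contradiction : ⊥
        contradiction = ℕₚ.1+n≰n (ℕₚ.≤-trans (restrictScalars-≤ β-dim W-dim family-independent family⊆W)
                                            (ℕₚ.≤-reflexive (≡.trans k'm≡2h (≡.cong (h ℕ.+_) (ℕₚ.+-identityʳ h)))))

      image-codim≤1 : ∀ {a} {α : Fin a → V 1} → Independent α → (∀ {u} → U' u → Span α (ψ u)) → m ≤ suc a
      image-codim≤1 {a} α-independent ψU'⊆α with m ℕ.≤? suc a
      ... | yes m≤1+a = m≤1+a
      ... | no m≰1+a = ⊥-elim (CodimensionTwo.contradiction α-independent ψU'⊆α (ℕₚ.≰⇒> m≰1+a))

      weight-upper-bound : ∀ {w} → HasWeight K Fq U Ω w → w ℕ.+ m ≤ suc (h ℕ.+ i)
      weight-upper-bound {w} UΩ-dim = ℕₚ.≤-trans (ℕₚ.+-monoʳ-≤ w (image-codim≤1 α-independent ψU'⊆α))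
                                    (ℕₚ.≤-trans (ℕₚ.≤-reflexive (ℕₚ.+-suc w _)) (s≤s nullity+rank))
        where
        open Extension (extend {E = []} (λ _ → yes tt) (λ _ _ _ ()) (ψ ∘ U'.vectors))
        open IsLinear ψ-Fq-linear
        G : Fin (size ℕ.+ 0) → V (suc k')
        G = (U'.vectors ∘ pick) ++ []
        α-independent : Independent (ψ ∘ G)
        α-independent = independent-cong (λ j → ≋-reflexive (≡.sym (∘-++-[] ψ _ j))) independent
        ψU'⊆α : ∀ {u} → U' u → Span (ψ ∘ G) (ψ u)
        ψU'⊆α U'u = let (c , Pc , c≋u) = U'.spans U'u in
          span-resp (≋-trans (≋-sym (homo-linComb Pc U'.vectors)) (cong c≋u))
            (span-linComb Pc (λ l → span-cong (λ j → ≋-reflexive (≡.sym (∘-++-[] ψ _ j))) (spans l tt)))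
        nullity+rank : w ℕ.+ (size ℕ.+ 0) ≤ h ℕ.+ i
        nullity+rank = nullity+rank≤dim ψ-Fq-linear U-dim UΩ-dim (λ _ → Ω⊆ker-ψ)
                                        (++⁺ U (U'⊆U ∘ U'.∈S ∘ pick) (λ ())) α-independent

    weight∈spectrum : Σ ℕ λ w → HasWeight K Fq U Ω w × WeightSpectrum w
    weight∈spectrum with Finₚ.all? (Ω? ∘ W-basis.vectors)
    ... | yes W-basis⊆Ω = h , weight-⊇W (λ v Wv → K-linear.Subspace.∋-span Ω-isSubspace W-basis⊆Ω (W-basis.spans Wv)) ,
                          inj₁ ≡.refl
    ... | no W-basis⊄Ω with Finₚ.¬∀⟶∃¬ k' _ (Ω? ∘ W-basis.vectors) W-basis⊄Ω | weight-exists
    ...   | l , y∉Ω | w , UΩ-dim = w , UΩ-dim , inj₂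
      ( m≤n+o⇒m-n≤o (ℕₚ.≤-trans (ℕₚ.m≤m+n h i) (weight-lower-bound UΩ-dim))
      , ≡.subst (+ w ℤ.≤_) (+[1+a+c]-b≡a-b+c+1 h m i) (m+n≤o⇒m≤o-n (weight-upper-bound UΩ-dim)))
      where open Transversal (W-basis.∈S l) y∉Ω

open import Data.Nat using (_*_; _∸_; _^_)
open import Data.Integer using (_-_; _+_) renaming (_≤_ to _≤ℤ_)

theorem5p6 :
    (K : CommutativeRing 0ℓ 0ℓ) → IsField K →
    (q m k : ℕ) → IsPrimePower q → 1 ≤ m → 1 ≤ k →
    -- (k-1)m is even, h = (k-1)m/2
    (h : ℕ) → (k ∸ 1) * m ≡ 2 * h →
    -- K ≅ F_{q^m}, Fq its subfield of order q
    HasCard K (Full K) (q ^ m) →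
    (Fq : CommutativeRing.Carrier K → Set) → IsSubfield K Fq → HasCard K Fq q →
    -- W a (k-1)-dimensional K-subspace of K^k
    (W : Vect K k → Set) → IsSubspace K (Full K) W → HasDim K (Full K) W (k ∸ 1) →
    -- U' ⊆ W with L_{U'} maximum scattered in PG(W)
    (U' : Vect K k → Set) → IsSubspace K Fq U' → _⊆_ K U' W →
    Scattered K Fq U' → HasDim K Fq U' h →
    -- x with ⟨x⟩ ∩ W = {0}
    (x : Vect K k) → (∀ v → span1 K x v → W v → _≈v_ K v (0v K)) →
    -- i ≥ m/2 positive, U'' ⊆ ⟨x⟩ of Fq-dimension i
    (i : ℕ) → 1 ≤ i → m ≤ 2 * i →
    (U'' : Vect K k → Set) → IsSubspace K Fq U'' → _⊆_ K U'' (span1 K x) →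
    HasDim K Fq U'' i →
    (∀ (Ω : Vect K k → Set) → IsHyperplane K Ω →
       Σ ℕ λ w → HasWeight K Fq (_⊕_ K U' U'') Ω w ×
         ((w ≡ h) ⊎ (((+ h) - (+ m) ≤ℤ (+ w)) × ((+ w) ≤ℤ (+ h) - (+ m) + (+ i) + (+ 1)))))
    ×
    (Σ (Vect K k → Set) λ Ω → IsHyperplane K Ω × HasWeight K Fq (_⊕_ K U' U'') Ω h)
theorem5p6 K K-isField q m zero _ _ ()
theorem5p6 K K-isField q m (suc k') _ _ _ h k'm≡2h K-card Fq Fq-isSubfield Fq-card W W-isSubspace W-dim
           U' U'-isSubspace U'⊆W U'-scattered U'-dim x x-transversal i _ _ U'' U''-isSubspace U''⊆⟨x⟩ U''-dim =
  (λ Ω (Ω-isSubspace , Ω-dim) → Hyperplane.weight∈spectrum Ω-isSubspace Ω-dim) ,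
  (W , (W-isSubspace , W-dim) , Hyperplane.weight-⊇W W-isSubspace W-dim (λ _ Wv → Wv))
  where
  open Configuration K K-isField k'm≡2h K-card Fq-isSubfield Fq-card W-isSubspace W-dim U'-isSubspace U'⊆W
                     U'-scattered U'-dim x-transversal U''-isSubspace U''⊆⟨x⟩ U''-dim
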